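{- Let $p>3$ be a prime, $k$ an integer with $0\le k\le p-1$ and $k\neq3$, $e\ge1$, and $l_1,l_2,l_3$ non-negative integers. Assume that $\frac{3k}{2(k-3)}\in\mathbb{F}_p$ is a quadratic residue of $p$. Then $D_{p^{l_1}+p^{l_2}+p^{l_3},k}(1,x)$ is a permutation polynomial of $\mathbb{F}_{p^e}$ if and only if $l_1=l_2=l_3=0$.
   Context: For an odd prime $p$ and $0\le k\le p-1$: for $n\ge 1$, $D_{n,k}(1,x)=\sum_{i=0}^{\lfloor n/2\rfloor}\frac{n-ki}{n-i}\binom{n-i}{i}(-x)^i$, where the coefficient is the integer $\binom{n-i}{i}-(k-1)\binom{n-i-1}{i-1}$ (with $\binom{m}{ -1}=0$) viewed in $\mathbb{F}_p$; $D_{0,k}(1,x)=2-k$. Equivalently $D_{1,k}=1$ and $D_{n,k}=D_{n-1,k}-xD_{n-2,k}$ for $n\ge2$. A polynomial over $\mathbb{F}_q$ is a permutation polynomial of $\mathbb{F}_q$ if it induces a bijection of $\mathbb{F}_q$. An element $c\in\mathbb{F}_p$ is a quadratic residue of $p$ if $c=\beta^2$ for some $\beta\in\mathbb{F}_p^*$; a nonzero element that is not of this form is a quadratic non-residue. -}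

module Defs where

open import Level using (0ℓ)
open import Data.Nat using (ℕ; zero; suc)
open import Data.Fin using (Fin)
open import Data.Product using (∃; _×_)
open import Data.Integer as ℤ using (ℤ)
open import Data.Integer.Divisibility using () renaming (_∣_ to _∣ℤ_)
open import Relation.Nullary using (¬_)
open import Relation.Binary.PropositionalEquality as ≡ using (_≡_)
open import Algebra.Bundles using (CommutativeRing)
open import Function.Bundles using (Bijection)
open import Function.Definitions using (Bijective)

record Field : Set₁ where
  field
    commRing : CommutativeRing 0ℓ 0ℓ
  open CommutativeRing commRing public
  field
    1≉0     : ¬ (1# ≈ 0#)
    inverse : ∀ x → ¬ (x ≈ 0#) → ∃ λ y → x * y ≈ 1#

HasOrder : Field → ℕ → Set
HasOrder F q = Bijection (≡.setoid (Fin q)) (Field.setoid F)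

module _ (F : Field) where
  open Field F

  natF : ℕ → Carrier
  natF zero    = 0#
  natF (suc n) = 1# + natF n

  D : ℕ → ℕ → Carrier → Carrier
  D k zero          x = natF 2 - natF k
  D k (suc zero)    x = 1#
  D k (suc (suc n)) x = D k (suc n) x - x * D k n x

  IsPermPoly : ℕ → ℕ → Set
  IsPermPoly k n = Bijective _≈_ _≈_ (D k n)

-- 3k / (2(k-3)) is a quadratic residue mod p (for k ≢ 3 mod p, so the
-- denominator is invertible): ∃ β ∈ ℤ, p ∤ β and β² · 2(k-3) ≡ 3k (mod p).
QRCond : ℕ → ℕ → Set
QRCond p k = ∃ λ (β : ℤ) → ¬ (ℤ.+ p ∣ℤ β) ×
  (ℤ.+ p ∣ℤ ((β ℤ.* β) ℤ.* (ℤ.+ 2 ℤ.* (ℤ.+ k ℤ.- ℤ.+ 3)) ℤ.- ℤ.+ 3 ℤ.* ℤ.+ k))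

module Submission where

-- In A = F[T]/(T² - T + x) we have D_n(x) = Φ(Tⁿ) for a linear form Φ.  For x
-- in the prime field 𝔽ₚ, Frobenius gives T^(pˡ) = εˡT + (1 - εˡ)/2 with
-- ε = (1 - 4x)^((p-1)/2) ∈ {0, ±1}, so on 𝔽ₚ the value of D_n depends only on
-- ε(x) and on the numbers J and R of zero and of odd exponents.  If all lᵢ = 0,
-- D_n = D₃ is affine with slope k - 3 ≠ 0.  Otherwise two points of 𝔽ₚ have
-- the same value: for J = 0 by the residue condition, for R = 0 at the
-- D₃-preimage of D_n(1/4), and for R ∈ {1, 2} by explicit points (p = 5) or a
-- Hermite moment argument with the vanishing power sums Σ iᵗ (p ≥ 7).

open import Level using (0ℓ)
open import Algebra.Bundles using (CommutativeRing)
import Data.Nat as ℕ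
open import Data.Nat using (ℕ)
open import Data.Nat.Primality using (Prime)
open import Relation.Nullary using (¬_)
open import Relation.Binary.PropositionalEquality using (_≡_)
open import Defs

module PrimeArithmetic where

  open import Data.Nat as ℕ using (ℕ; zero; suc; _+_; _*_; _∸_; _<_; _≤_; z≤n; s≤s; _!; _%_; _/_)
  open import Data.Nat.Properties
  open import Data.Nat.Divisibility using (_∣_; divides; ∣⇒≤; ∣1⇒≡1)
  open import Data.Nat.DivMod using (m/n*n≡m; m≡m%n+[m/n]*n; m%n<n)
  open import Data.Nat.Primality
  open import Data.Nat.Combinatorics using (_C_; k![n∸k]!∣n!)
  open import Data.Nat.Combinatorics.Specification using (nCk≡n!/k![n-k]!)
  open import Data.Product using (∃; _,_)
  open import Data.Sum using (_⊎_; inj₁; inj₂)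
  open import Data.Empty using (⊥-elim)
  open import Relation.Nullary using (¬_)
  open import Relation.Binary.PropositionalEquality

  OddWith : ℕ → ℕ → Set
  OddWith p h = p ≡ suc (h + h)

  module _ {p : ℕ} (pp : Prime p) where

    prime∤small : ∀ {m} → 0 < m → m < p → ¬ (p ∣ m)
    prime∤small 0<m m<p p∣m = <⇒≱ m<p (∣⇒≤ {{ℕ.>-nonZero 0<m}} p∣m)

    prime∤factorial : ∀ m → m < p → ¬ (p ∣ m !)
    prime∤factorial zero    _   p∣1 = ¬prime[1] (subst Prime (∣1⇒≡1 p∣1) pp)
    prime∤factorial (suc m) m<p p∣ with euclidsLemma (suc m) (m !) pp p∣
    ... | inj₁ p∣m  = prime∤small (s≤s z≤n) m<p p∣m
    ... | inj₂ p∣m! = prime∤factorial m (<-trans (n<1+n m) m<p) p∣m!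

    -- p divides the binomial coefficient C(p,k) for 0 < k < p, because
    -- C(p,k) · k! (p-k)! = p! and p divides neither k! nor (p-k)!.
    prime∣binomial : ∀ k → 0 < k → k < p → p ∣ (p C k)
    prime∣binomial k 0<k k<p
      with euclidsLemma (p C k) (k ! * (p ∸ k) !) pp p∣product
      where
      instance _ = k !* (p ∸ k) !≢0
      product≡p! : (p C k) * (k ! * (p ∸ k) !) ≡ p !
      product≡p! = trans (cong (_* (k ! * (p ∸ k) !)) (nCk≡n!/k![n-k]! (<⇒≤ k<p)))
                         (m/n*n≡m (k![n∸k]!∣n! (<⇒≤ k<p)))
      p∣p! : p ∣ p !
      p∣p! = subst (λ n → n ∣ n !) (suc-pred p {{prime⇒nonZero pp}})
                   (divides (ℕ.pred p !) (*-comm (suc (ℕ.pred p)) (ℕ.pred p !)))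
      p∣product : p ∣ (p C k) * (k ! * (p ∸ k) !)
      p∣product = subst (p ∣_) (sym product≡p!) p∣p!
    ... | inj₁ p∣C = p∣C
    ... | inj₂ p∣k![p∸k]! with euclidsLemma (k !) ((p ∸ k) !) pp p∣k![p∸k]!
    ...   | inj₁ p∣k!     = ⊥-elim (prime∤factorial k k<p p∣k!)
    ...   | inj₂ p∣[p∸k]! = ⊥-elim (prime∤factorial (p ∸ k) (∸-monoʳ-< 0<k (<⇒≤ k<p)) p∣[p∸k]!)

    odd-prime : 2 < p → ∃ (OddWith p)
    odd-prime 2<p with p % 2 | m≡m%n+[m/n]*n p 2 | m%n<n p 2
    ... | 0 | p≡ | _ = ⊥-elim (prime⇒¬composite pp (composite {2} 2<p (divides (p / 2) p≡)))
    ... | 1 | p≡ | _ = p / 2 , trans p≡ (cong suc (trans (*-comm (p / 2) 2)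
                                                 (cong (p / 2 +_) (+-identityʳ (p / 2)))))
    ... | suc (suc _) | _ | s≤s (s≤s ())

    half-positive : ∀ {h} → OddWith p h → 1 ≤ h
    half-positive {zero}  p≡1 = ⊥-elim (¬prime[1] (subst Prime p≡1 pp))
    half-positive {suc h} _   = s≤s z≤n

  five-or-≥7 : ∀ {p} → Prime p → 3 < p → p ≡ 5 ⊎ 7 ≤ p
  five-or-≥7 {2} _ (s≤s (s≤s ()))
  five-or-≥7 {3} _ (s≤s (s≤s (s≤s ())))
  five-or-≥7 {4} pp _ = ⊥-elim (prime⇒¬composite pp composite[4])
  five-or-≥7 {5} _  _ = inj₁ refl
  five-or-≥7 {6} pp _ = ⊥-elim (prime⇒¬composite pp composite[6])
  five-or-≥7 {suc (suc (suc (suc (suc (suc (suc _))))))} _ _ = inj₂ (s≤s (s≤s (s≤s (s≤s (s≤s (s≤s (s≤s z≤n)))))))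

  half-≥3 : ∀ {p h} → OddWith p h → 7 ≤ p → 3 ≤ h
  half-≥3 {h = 0} refl (s≤s ())
  half-≥3 {h = 1} refl (s≤s (s≤s (s≤s ())))
  half-≥3 {h = 2} refl (s≤s (s≤s (s≤s (s≤s (s≤s ())))))
  half-≥3 {h = suc (suc (suc _))} _ _ = s≤s (s≤s (s≤s z≤n))

  half-of-5 : ∀ {h} → OddWith 5 h → h ≡ 2
  half-of-5 {h} 5≡2h+1 = *-cancelˡ-≡ h 2 2
    (trans (cong (h +_) (+-identityʳ h)) (suc-injective (sym 5≡2h+1)))

-- Counting the exponents l of a list with a given boolean property
-- (l = 0, l odd): the bookkeeping behind the case distinctions on
-- N = p^l₁ + p^l₂ + p^l₃.
module ExponentCounting where

  open import Data.Nat as ℕ using (ℕ; zero; suc; _+_; _≤_; z≤n; s≤s)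
  import Data.Nat.Properties as ℕP
  open import Data.Bool using (Bool; true; false; if_then_else_; not)
  open import Data.List using (List; []; _∷_; length)
  open import Data.List.Relation.Unary.All using (All; []; _∷_)
  open import Relation.Binary.PropositionalEquality

  is-zero : ℕ → Bool
  is-zero zero    = true
  is-zero (suc _) = false

  is-odd : ℕ → Bool
  is-odd zero    = false
  is-odd (suc l) = not (is-odd l)

  count : (ℕ → Bool) → List ℕ → ℕ
  count b []       = 0
  count b (l ∷ ls) = if b l then suc (count b ls) else count b ls

  count≤length : ∀ b ls → count b ls ≤ length ls
  count≤length b []       = z≤n
  count≤length b (l ∷ ls) with b l
  ... | true  = s≤s (count≤length b ls)
  ... | false = ℕP.m≤n⇒m≤1+n (count≤length b ls)

  count-full : ∀ b ls → count b ls ≡ length ls → All (λ l → b l ≡ true) ls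
  count-full b []       _  = []
  count-full b (l ∷ ls) eq with b l in bl
  ... | true  = bl ∷ count-full b ls (ℕP.suc-injective eq)
  ... | false = ⊥-elim (ℕP.<-irrefl eq (s≤s (count≤length b ls)))
    where open import Data.Empty using (⊥-elim)

  count-disjoint : ∀ b c → (∀ l → b l ≡ true → c l ≡ false) →
                   ∀ ls → count b ls + count c ls ≤ length ls
  count-disjoint b c disjoint []       = z≤n
  count-disjoint b c disjoint (l ∷ ls) with b l in bl | c l in cl
  ... | true  | true  with () ← trans (sym cl) (disjoint l bl)
  ... | true  | false = s≤s (count-disjoint b c disjoint ls)
  ... | false | true  = ℕP.≤-trans (ℕP.≤-reflexive (ℕP.+-suc _ _)) (s≤s (count-disjoint b c disjoint ls))
  ... | false | false = ℕP.m≤n⇒m≤1+n (count-disjoint b c disjoint ls)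

  is-zero-sound : ∀ {l} → is-zero l ≡ true → l ≡ 0
  is-zero-sound {zero} _ = refl

  zero-not-odd : ∀ l → is-zero l ≡ true → is-odd l ≡ false
  zero-not-odd zero _ = refl

open PrimeArithmetic using (OddWith)

-- Elementary facts valid in every commutative ring R: the canonical maps
-- ℕ → R and ℤ → R are ring homomorphisms, which is what lets us run the
-- standard library's ring solver with integer coefficients over R.
module RingFacts (R : CommutativeRing 0ℓ 0ℓ) where

  open import Data.Nat as ℕ using (ℕ; zero; suc)
  import Data.Nat.Properties as ℕP
  open import Data.Integer as ℤ using (ℤ; +_; -[1+_])
  import Data.Integer.Properties as ℤP
  open import Data.Sign as Sign using (Sign)
  open import Data.Maybe using (Maybe; just; nothing)
  open import Data.Bool using (Bool; true; false; if_then_else_)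
  open import Data.List using (List; []; _∷_; foldr; map; length)
  open import Data.Nat.ListAction using (sum)
  open ExponentCounting using (count; count≤length)
  open import Relation.Nullary using (yes; no)
  open import Relation.Binary.PropositionalEquality as ≡ using (_≡_)
  open import Algebra.Bundles using (RawRing)
  import Algebra.Solver.Ring
  import Algebra.Solver.Ring.AlmostCommutativeRing as ACR

  open CommutativeRing R public hiding (zero)
  open import Relation.Binary.Reasoning.Setoid setoid public
  open import Algebra.Properties.Ring ring public
    using (-‿involutive; -0#≈0#; -‿distribˡ-*; -‿+-comm)
  open import Algebra.Properties.CommutativeSemigroup +-commutativeSemigroup
    using (interchange)
  open import Algebra.Properties.Semiring.Exp semiring public
  open import Algebra.Properties.CommutativeSemiring.Exp commutativeSemiring public
    using (^-distrib-*)

  -- The image of a natural number (1 is sent to 1# itself, so that the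
  -- embedding preserves 1 definitionally).
  natR : ℕ → Carrier
  natR zero          = 0#
  natR (suc zero)    = 1#
  natR (suc (suc n)) = 1# + natR (suc n)

  natR-suc : ∀ n → natR (suc n) ≈ 1# + natR n
  natR-suc zero    = sym (+-identityʳ 1#)
  natR-suc (suc n) = refl

  natR-+ : ∀ m n → natR (m ℕ.+ n) ≈ natR m + natR n
  natR-+ zero    n = sym (+-identityˡ _)
  natR-+ (suc m) n = begin
    natR (suc (m ℕ.+ n))     ≈⟨ natR-suc (m ℕ.+ n) ⟩
    1# + natR (m ℕ.+ n)      ≈⟨ +-congˡ (natR-+ m n) ⟩
    1# + (natR m + natR n)   ≈⟨ +-assoc 1# _ _ ⟨
    (1# + natR m) + natR n   ≈⟨ +-congʳ (natR-suc m) ⟨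
    natR (suc m) + natR n    ∎

  natR-* : ∀ m n → natR (m ℕ.* n) ≈ natR m * natR n
  natR-* zero    n = sym (zeroˡ _)
  natR-* (suc m) n = begin
    natR (n ℕ.+ m ℕ.* n)             ≈⟨ natR-+ n (m ℕ.* n) ⟩
    natR n + natR (m ℕ.* n)          ≈⟨ +-cong (sym (*-identityˡ _)) (natR-* m n) ⟩
    1# * natR n + natR m * natR n    ≈⟨ distribʳ _ _ _ ⟨
    (1# + natR m) * natR n           ≈⟨ *-congʳ (natR-suc m) ⟨
    natR (suc m) * natR n            ∎

  natR-^ : ∀ m e → natR (m ℕ.^ e) ≈ natR m ^ e
  natR-^ m zero    = refl
  natR-^ m (suc e) = trans (natR-* m (m ℕ.^ e)) (*-congˡ (natR-^ m e))

  power-of-zero : ∀ {y} n → 1 ℕ.≤ n → y ≈ 0# → y ^ n ≈ 0#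
  power-of-zero (suc n) _ y≈0 = trans (*-congʳ y≈0) (zeroˡ _)

  ∏ : List Carrier → Carrier
  ∏ = foldr _*_ 1#

  ^-sum : ∀ a ns → a ^ sum ns ≈ ∏ (map (a ^_) ns)
  ^-sum a []       = refl
  ^-sum a (n ∷ ns) = trans (^-homo-* a n (sum ns)) (*-congˡ (^-sum a ns))

  ∏-constant : ∀ (a : Carrier) (g : ℕ → Carrier) → (∀ l → g l ≈ a) →
               ∀ ls → ∏ (map g ls) ≈ a ^ length ls
  ∏-constant a g g≈a []       = refl
  ∏-constant a g g≈a (l ∷ ls) = *-cong (g≈a l) (∏-constant a g g≈a ls)

  ∏-select : ∀ (b : ℕ → Bool) (a c : Carrier) (g : ℕ → Carrier) →
             (∀ l → g l ≈ (if b l then a else c)) →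
             ∀ ls → ∏ (map g ls) ≈ a ^ count b ls * c ^ (length ls ℕ.∸ count b ls)
  ∏-select b a c g g≈ []       = sym (*-identityˡ 1#)
  ∏-select b a c g g≈ (l ∷ ls) with b l | g≈ l
  ... | true  | gl≈a = trans (*-cong gl≈a (∏-select b a c g g≈ ls)) (sym (*-assoc _ _ _))
  ... | false | gl≈c = begin
    g l * ∏ (map g ls)                 ≈⟨ *-cong gl≈c (∏-select b a c g g≈ ls) ⟩
    c * (a ^ m * c ^ (n ℕ.∸ m))        ≈⟨ x∙yz≈y∙xz c (a ^ m) _ ⟩
    a ^ m * (c * c ^ (n ℕ.∸ m))        ≡⟨ ≡.cong (λ e → a ^ m * c ^ e) (ℕP.+-∸-assoc 1 (count≤length b ls)) ⟨
    a ^ m * c ^ (suc n ℕ.∸ m)          ∎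
    where
    m n : ℕ
    m = count b ls
    n = length ls
    open import Algebra.Properties.CommutativeSemigroup *-commutativeSemigroup using (x∙yz≈y∙xz)

  natZ : ℤ → Carrier
  natZ (+ n)    = natR n
  natZ -[1+ n ] = - natR (suc n)

  natZ-neg : ∀ i → natZ (ℤ.- i) ≈ - natZ i
  natZ-neg -[1+ n ]   = sym (-‿involutive _)
  natZ-neg (+ zero)   = sym -0#≈0#
  natZ-neg (+ suc n)  = refl

  shift-difference : ∀ a b c → (c + a) - (c + b) ≈ a - b
  shift-difference a b c = begin
    (c + a) - (c + b)      ≈⟨ +-congˡ (-‿+-comm c b) ⟨
    (c + a) + (- c - b)    ≈⟨ interchange c a (- c) (- b) ⟩
    (c - c) + (a - b)      ≈⟨ +-congʳ (-‿inverseʳ c) ⟩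
    0# + (a - b)           ≈⟨ +-identityˡ _ ⟩
    a - b                  ∎

  natZ-⊖ : ∀ m n → natZ (m ℤ.⊖ n) ≈ natR m - natR n
  natZ-⊖ m zero = begin
    natZ (m ℤ.⊖ 0)   ≡⟨ ≡.cong natZ (ℤP.⊖-≥ {m} {0} ℕ.z≤n) ⟩
    natR m           ≈⟨ +-identityʳ _ ⟨
    natR m + 0#      ≈⟨ +-congˡ -0#≈0# ⟨
    natR m - 0#      ∎
  natZ-⊖ zero (suc n) = begin
    natZ (0 ℤ.⊖ suc n)     ≡⟨ ≡.cong natZ (ℤP.⊖-≤ {0} {suc n} ℕ.z≤n) ⟩
    - natR (suc n)         ≈⟨ +-identityˡ _ ⟨
    0# - natR (suc n)      ∎
  natZ-⊖ (suc m) (suc n) = begin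
    natZ (suc m ℤ.⊖ suc n)             ≡⟨ ≡.cong natZ (ℤP.[1+m]⊖[1+n]≡m⊖n m n) ⟩
    natZ (m ℤ.⊖ n)                     ≈⟨ natZ-⊖ m n ⟩
    natR m - natR n                    ≈⟨ shift-difference (natR m) (natR n) 1# ⟨
    (1# + natR m) - (1# + natR n)      ≈⟨ +-cong (natR-suc m) (-‿cong (natR-suc n)) ⟨
    natR (suc m) - natR (suc n)        ∎

  natZ-+ : ∀ i j → natZ (i ℤ.+ j) ≈ natZ i + natZ j
  natZ-+ -[1+ m ] -[1+ n ] = begin
    - natR (suc (suc (m ℕ.+ n)))          ≡⟨ ≡.cong (λ k → - natR (suc k)) (ℕP.+-suc m n) ⟨
    - natR (suc m ℕ.+ suc n)              ≈⟨ -‿cong (natR-+ (suc m) (suc n)) ⟩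
    - (natR (suc m) + natR (suc n))       ≈⟨ -‿+-comm _ _ ⟨
    - natR (suc m) - natR (suc n)         ∎
  natZ-+ -[1+ m ] (+ n)    = trans (natZ-⊖ n (suc m)) (+-comm _ _)
  natZ-+ (+ m)    -[1+ n ] = natZ-⊖ m (suc n)
  natZ-+ (+ m)    (+ n)    = natR-+ m n

  sgn : Sign → Carrier
  sgn Sign.+ = 1#
  sgn Sign.- = - 1#

  sgn-* : ∀ s t → sgn (s Sign.* t) ≈ sgn s * sgn t
  sgn-* Sign.- Sign.- = begin
    1#               ≈⟨ -‿involutive 1# ⟨
    - (- 1#)         ≈⟨ -‿cong (*-identityˡ (- 1#)) ⟨
    - (1# * - 1#)    ≈⟨ -‿distribˡ-* 1# (- 1#) ⟩
    - 1# * - 1#      ∎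
  sgn-* Sign.- Sign.+ = sym (*-identityʳ _)
  sgn-* Sign.+ _      = sym (*-identityˡ _)

  sgn-natR : ∀ s n → natZ (s ℤ.◃ n) ≈ sgn s * natR n
  sgn-natR s      zero    = sym (zeroʳ _)
  sgn-natR Sign.+ (suc n) = sym (*-identityˡ _)
  sgn-natR Sign.- (suc n) = trans (-‿cong (sym (*-identityˡ _))) (-‿distribˡ-* _ _)

  natZ-sgn : ∀ i → natZ i ≈ sgn (ℤ.sign i) * natR ℤ.∣ i ∣
  natZ-sgn i = trans (reflexive (≡.cong natZ (≡.sym (ℤP.◃-inverse i))))
                     (sgn-natR (ℤ.sign i) ℤ.∣ i ∣)

  natZ-* : ∀ i j → natZ (i ℤ.* j) ≈ natZ i * natZ j
  natZ-* i j = begin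
    natZ (i ℤ.* j)                                ≈⟨ sgn-natR (sᵢ Sign.* sⱼ) (aᵢ ℕ.* aⱼ) ⟩
    sgn (sᵢ Sign.* sⱼ) * natR (aᵢ ℕ.* aⱼ)         ≈⟨ *-cong (sgn-* sᵢ sⱼ) (natR-* aᵢ aⱼ) ⟩
    (sgn sᵢ * sgn sⱼ) * (natR aᵢ * natR aⱼ)       ≈⟨ interchange* _ _ _ _ ⟩
    (sgn sᵢ * natR aᵢ) * (sgn sⱼ * natR aⱼ)       ≈⟨ *-cong (natZ-sgn i) (natZ-sgn j) ⟨
    natZ i * natZ j                               ∎
    where
    sᵢ sⱼ : Sign
    sᵢ = ℤ.sign i ; sⱼ = ℤ.sign j
    aᵢ aⱼ : ℕ
    aᵢ = ℤ.∣ i ∣ ; aⱼ = ℤ.∣ j ∣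
    open import Algebra.Properties.CommutativeSemigroup *-commutativeSemigroup
      renaming (interchange to interchange*)

  private
    ℤ-rawRing : RawRing 0ℓ 0ℓ
    ℤ-rawRing = record { Carrier = ℤ ; _≈_ = _≡_ ; _+_ = ℤ._+_ ; _*_ = ℤ._*_
                       ; -_ = ℤ.-_ ; 0# = + 0 ; 1# = + 1 }

    R-almost : ACR.AlmostCommutativeRing 0ℓ 0ℓ
    R-almost = ACR.fromCommutativeRing R

    ℤ⟶R : ℤ-rawRing ACR.-Raw-AlmostCommutative⟶ R-almost
    ℤ⟶R = record { ⟦_⟧ = natZ ; +-homo = natZ-+ ; *-homo = natZ-* ; -‿homo = natZ-neg
                 ; 0-homo = refl ; 1-homo = refl }

    ℤ-equal? : ∀ a b → Maybe (natZ a ≈ natZ b)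
    ℤ-equal? a b with a ℤ.≟ b
    ... | yes ≡.refl = just refl
    ... | no _       = nothing

  module Solver where
    open Algebra.Solver.Ring ℤ-rawRing R-almost ℤ⟶R ℤ-equal? public
    :0 :1 :2 :3 : ∀ {n} → Polynomial n
    :0 = con (+ 0)
    :1 = con (+ 1)
    :2 = con (+ 2)
    :3 = con (+ 3)

module FinitePermutations where

  open import Data.Nat using (suc)
  import Data.Nat.Properties as ℕP
  open import Data.Fin as Fin using (Fin; punchOut)
  import Data.Fin.Properties as FinP
  open import Data.Fin.Permutation using (Permutation; permutation)
  open import Data.Product using (∃; _,_; proj₁; proj₂)
  open import Relation.Nullary using (yes; no)
  open import Relation.Binary.PropositionalEquality using (_≡_; _≢_; sym; refl)
  open import Data.Empty using (⊥-elim)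

  injective⇒surjective : ∀ n (g : Fin n → Fin n) → (∀ {i j} → g i ≡ g j → i ≡ j) →
                         ∀ y → ∃ λ x → g x ≡ y
  injective⇒surjective (suc n) g g-inj y with FinP.any? (λ x → g x Fin.≟ y)
  ... | yes hit = hit
  ... | no miss = ⊥-elim (ℕP.<-irrefl refl (FinP.injective⇒≤ {f = squeeze} squeeze-inj))
    where
    -- if y were missed, g would inject Fin (suc n) into Fin n
    y≢g : ∀ x → y ≢ g x
    y≢g x eq = miss (x , sym eq)
    squeeze : Fin (suc n) → Fin n
    squeeze x = punchOut (y≢g x)
    squeeze-inj : ∀ {a b} → squeeze a ≡ squeeze b → a ≡ b
    squeeze-inj eq = g-inj (FinP.punchOut-injective (y≢g _) (y≢g _) eq)

  injective⇒permutation : ∀ n (g : Fin n → Fin n) → (∀ {i j} → g i ≡ g j → i ≡ j) →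
                          Permutation n n
  injective⇒permutation n g g-inj = permutation g g⁻¹
      (λ y → proj₂ (injective⇒surjective n g g-inj y))
      (λ x → g-inj (proj₂ (injective⇒surjective n g g-inj (g x))))
    where
    g⁻¹ : Fin n → Fin n
    g⁻¹ y = proj₁ (injective⇒surjective n g g-inj y)

module Sums (R : CommutativeRing 0ℓ 0ℓ) where

  open import Data.Nat as ℕ using (zero; suc; _<_; _∸_; z≤n; s≤s)
  open import Data.Nat.Combinatorics using (_C_)
  open import Data.Fin as Fin using (Fin; toℕ)
  open import Relation.Binary.PropositionalEquality as ≡ using (_≡_)
  open RingFacts R
  open Solver
  open import Algebra.Properties.CommutativeMonoid.Sum +-commutativeMonoid
    using (sum; sum-permute)
  open import Algebra.Properties.Semiring.Mult semiring using (_×_; ×-congʳ; ×-assoc-*)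
  open import Algebra.Properties.CommutativeSemiring.Binomial commutativeSemiring
    using (theorem; binomialExpansion)

  Σ : ℕ → (ℕ → Carrier) → Carrier
  Σ zero    g = 0#
  Σ (suc n) g = g 0 + Σ n (λ i → g (suc i))

  Σ-cong : ∀ n {f g : ℕ → Carrier} → (∀ i → i < n → f i ≈ g i) → Σ n f ≈ Σ n g
  Σ-cong zero    _  = refl
  Σ-cong (suc n) eq = +-cong (eq 0 (s≤s z≤n)) (Σ-cong n (λ i i<n → eq (suc i) (s≤s i<n)))

  Σ-0 : ∀ n → Σ n (λ _ → 0#) ≈ 0#
  Σ-0 zero    = refl
  Σ-0 (suc n) = trans (+-identityˡ _) (Σ-0 n)

  Σ-1 : ∀ n → Σ n (λ _ → 1#) ≈ natR n
  Σ-1 zero    = refl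
  Σ-1 (suc n) = trans (+-congˡ (Σ-1 n)) (sym (natR-suc n))

  Σ-vanish : ∀ n {g : ℕ → Carrier} → (∀ i → i < n → g i ≈ 0#) → Σ n g ≈ 0#
  Σ-vanish n z = trans (Σ-cong n z) (Σ-0 n)

  Σ-+ : ∀ n (f g : ℕ → Carrier) → Σ n (λ i → f i + g i) ≈ Σ n f + Σ n g
  Σ-+ zero    f g = sym (+-identityʳ _)
  Σ-+ (suc n) f g = trans (+-congˡ (Σ-+ n (λ i → f (suc i)) (λ i → g (suc i))))
    (solve 4 (λ a b c d → (a :+ b) :+ (c :+ d) := (a :+ c) :+ (b :+ d)) refl _ _ _ _)

  Σ-* : ∀ n c (f : ℕ → Carrier) → Σ n (λ i → c * f i) ≈ c * Σ n f
  Σ-* zero    c f = sym (zeroʳ _)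
  Σ-* (suc n) c f = trans (+-congˡ (Σ-* n c (λ i → f (suc i)))) (sym (distribˡ _ _ _))

  Σ-comm : ∀ m n (f : ℕ → ℕ → Carrier) →
           Σ m (λ i → Σ n (λ j → f i j)) ≈ Σ n (λ j → Σ m (λ i → f i j))
  Σ-comm zero    n f = sym (Σ-0 n)
  Σ-comm (suc m) n f = trans (+-congˡ (Σ-comm m n (λ i j → f (suc i) j)))
                             (sym (Σ-+ n (λ j → f 0 j) (λ j → Σ m (λ i → f (suc i) j))))

  Σ-telescope : ∀ n (g : ℕ → Carrier) → Σ n (λ i → g (suc i) - g i) ≈ g n - g 0
  Σ-telescope zero    g = sym (-‿inverseʳ _)
  Σ-telescope (suc n) g = trans (+-congˡ (Σ-telescope n (λ i → g (suc i))))
    (solve 3 (λ a b c → (b :- a) :+ (c :- b) := c :- a) refl (g 0) (g 1) (g (suc n)))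

  Σ-last : ∀ n (g : ℕ → Carrier) → Σ (suc n) g ≈ Σ n g + g n
  Σ-last zero    g = trans (+-identityʳ _) (sym (+-identityˡ _))
  Σ-last (suc n) g = trans (+-congˡ (Σ-last n (λ i → g (suc i)))) (sym (+-assoc _ _ _))

  sum≡Σ : ∀ n (g : ℕ → Carrier) → sum {n} (λ i → g (toℕ i)) ≡ Σ n g
  sum≡Σ zero    g = ≡.refl
  sum≡Σ (suc n) g = ≡.cong (g 0 +_) (sum≡Σ n (λ i → g (suc i)))

  Σ-reindex : ∀ n (σ : Fin n → Fin n) → (∀ {i j} → σ i ≡ σ j → i ≡ j) →
              (G : ℕ → Carrier) → sum {n} (λ i → G (toℕ (σ i))) ≈ Σ n G
  Σ-reindex n σ σ-inj G =
    trans (sym (sum-permute (λ i → G (toℕ i)) (FinitePermutations.injective⇒permutation n σ σ-inj)))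
          (reflexive (sum≡Σ n G))

  ×-as-natR : ∀ n x → n × x ≈ natR n * x
  ×-as-natR n x = begin
    n × x          ≈⟨ ×-congʳ n (*-identityˡ x) ⟨
    n × (1# * x)   ≈⟨ ×-assoc-* n 1# x ⟨
    (n × 1#) * x   ≈⟨ *-congʳ (×1≈natR n) ⟩
    natR n * x     ∎
    where
    ×1≈natR : ∀ n → n × 1# ≈ natR n
    ×1≈natR zero          = refl
    ×1≈natR (suc zero)    = +-identityʳ _
    ×1≈natR (suc (suc n)) = +-congˡ (×1≈natR (suc n))

  binomial : ∀ n a b → (a + b) ^ n ≈ Σ (suc n) (λ t → natR (n C t) * (a ^ t * b ^ (n ∸ t)))
  binomial n a b = begin
    (a + b) ^ n                                             ≈⟨ theorem n a b ⟩
    binomialExpansion a b n                                 ≡⟨ sum≡Σ (suc n) (λ t → (n C t) × term t) ⟩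
    Σ (suc n) (λ t → (n C t) × (a ^ t * b ^ (n ∸ t)))       ≈⟨ Σ-cong (suc n) (λ t _ → ×-as-natR (n C t) (term t)) ⟩
    Σ (suc n) (λ t → natR (n C t) * (a ^ t * b ^ (n ∸ t)))  ∎
    where
    term : ℕ → Carrier
    term t = a ^ t * b ^ (n ∸ t)

module Frobenius (R : CommutativeRing 0ℓ 0ℓ) {p : ℕ} (pp : Prime p) where

  open import Data.Nat as ℕ using (zero; suc; _<_; _∸_; z≤n; s≤s)
  import Data.Nat.Properties as ℕP
  open import Data.Nat.Divisibility using (divides)
  open import Data.Nat.Primality using (prime⇒nonZero)
  open import Data.Nat.Combinatorics using (_C_; nCn≡1)
  open import Relation.Binary.PropositionalEquality as ≡ using (_≡_)
  open PrimeArithmetic using (prime∣binomial)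
  open RingFacts R
  open Sums R

  -- Frobenius for a prime q = m + 1 with q = 0 in R: in the binomial expansion
  -- of (a + b)^q only the two outer terms survive, as q divides C(q, t).
  private
    frobenius-suc : ∀ m → Prime (suc m) → natR (suc m) ≈ 0# →
                    ∀ a b → (a + b) ^ suc m ≈ a ^ suc m + b ^ suc m
    frobenius-suc m q-prime char a b = begin
      (a + b) ^ suc m                                         ≈⟨ binomial (suc m) a b ⟩
      term 0 + Σ (suc m) (λ t → term (suc t))                 ≈⟨ +-congˡ (Σ-last m (λ t → term (suc t))) ⟩
      term 0 + (Σ m (λ t → term (suc t)) + term (suc m))      ≈⟨ +-congˡ (+-congʳ (Σ-vanish m middle)) ⟩
      term 0 + (0# + term (suc m))                            ≈⟨ +-cong first (trans (+-identityˡ _) last) ⟩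
      b ^ suc m + a ^ suc m                                   ≈⟨ +-comm _ _ ⟩
      a ^ suc m + b ^ suc m                                   ∎
      where
      term : ℕ → Carrier
      term t = natR (suc m C t) * (a ^ t * b ^ (suc m ∸ t))
      first : term 0 ≈ b ^ suc m
      first = trans (*-identityˡ _) (*-identityˡ _)
      last : term (suc m) ≈ a ^ suc m
      last = begin
        natR (suc m C suc m) * (a ^ suc m * b ^ (m ∸ m))  ≡⟨ ≡.cong₂ (λ c e → natR c * (a ^ suc m * b ^ e))
                                                               (nCn≡1 (suc m)) (ℕP.n∸n≡0 m) ⟩
        1# * (a ^ suc m * 1#)                             ≈⟨ trans (*-identityˡ _) (*-identityʳ _) ⟩
        a ^ suc m                                         ∎
      middle : ∀ t → t < m → term (suc t) ≈ 0#
      middle t t<m with prime∣binomial q-prime (suc t) (s≤s z≤n) (s≤s t<m)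
      ... | divides c eq = begin
        natR (suc m C suc t) * x       ≡⟨ ≡.cong (λ n → natR n * x) eq ⟩
        natR (c ℕ.* suc m) * x         ≈⟨ *-congʳ (natR-* c (suc m)) ⟩
        (natR c * natR (suc m)) * x    ≈⟨ *-congʳ (trans (*-congˡ char) (zeroʳ _)) ⟩
        0# * x                         ≈⟨ zeroˡ x ⟩
        0#                             ∎
        where
        x : Carrier
        x = a ^ suc t * b ^ (suc m ∸ suc t)

  module _ (char : natR p ≈ 0#) where

    frobenius : ∀ a b → (a + b) ^ p ≈ a ^ p + b ^ p
    frobenius = ≡.subst (λ q → Prime q → natR q ≈ 0# → ∀ a b → (a + b) ^ q ≈ a ^ q + b ^ q)
                        (ℕP.suc-pred p {{prime⇒nonZero pp}}) (frobenius-suc (ℕ.pred p)) pp char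

    fermat : ∀ m → natR m ^ p ≈ natR m
    fermat zero    = ≡.subst (λ e → 0# ^ e ≈ 0#) (ℕP.suc-pred p {{prime⇒nonZero pp}}) (zeroˡ _)
    fermat (suc m) = begin
      natR (suc m) ^ p          ≈⟨ ^-congˡ p (natR-suc m) ⟩
      (1# + natR m) ^ p         ≈⟨ frobenius 1# (natR m) ⟩
      1# ^ p + natR m ^ p       ≈⟨ +-cong (1#^ p) (fermat m) ⟩
      1# + natR m               ≈⟨ natR-suc m ⟨
      natR (suc m)              ∎
      where
      1#^ : ∀ n → 1# ^ n ≈ 1#
      1#^ zero    = refl
      1#^ (suc n) = trans (*-identityˡ _) (1#^ n)

module FiniteField (F : Field) {q : ℕ} (H : HasOrder F q) where

  open import Data.Nat as ℕ using (zero; suc)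
  open import Data.Fin as Fin using (Fin)
  open import Data.Fin.Permutation using (Permutation; permutation)
  open import Data.Product using (_,_; proj₁; proj₂)
  open import Data.Sum using (_⊎_; inj₁; inj₂)
  open import Relation.Nullary using (¬_; Dec; yes; no)
  open import Relation.Binary.PropositionalEquality as ≡ using (_≡_)
  open import Function.Bundles using (Bijection)
  open Field F using (1≉0; inverse)
  open Field F public using (commRing)
  open RingFacts commRing public
  open Solver
  open Bijection H using (to; injective; surjective)
  open import Algebra.Properties.CommutativeMonoid.Sum +-commutativeMonoid
    using (sum; sum-permute; ∑-distrib-+; sum-cong-≋)
  open Sums commRing using (Σ; Σ-1; sum≡Σ)

  natF≈natR : ∀ n → natF F n ≈ natR n
  natF≈natR zero    = refl
  natF≈natR (suc n) = trans (+-congˡ (natF≈natR n)) (sym (natR-suc n))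

  from : Carrier → Fin q
  from y = proj₁ (surjective y)

  to-from : ∀ y → to (from y) ≈ y
  to-from y = proj₂ (surjective y) ≡.refl

  _≟_ : ∀ x y → Dec (x ≈ y)
  x ≟ y with from x Fin.≟ from y
  ... | yes eq = yes (trans (sym (to-from x)) (trans (reflexive (≡.cong to eq)) (to-from y)))
  ... | no neq = no λ x≈y → neq (injective (trans (to-from x) (trans x≈y (sym (to-from y)))))

  difference≈0 : ∀ {a b} → a ≈ b → a - b ≈ 0#
  difference≈0 {a} {b} a≈b = trans (+-congʳ a≈b) (-‿inverseʳ b)

  difference≈0⇒≈ : ∀ {a b} → a - b ≈ 0# → a ≈ b
  difference≈0⇒≈ {a} {b} a-b≈0 = begin
    a              ≈⟨ solve 2 (λ a b → a := (a :- b) :+ b) refl a b ⟩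
    (a - b) + b    ≈⟨ +-congʳ a-b≈0 ⟩
    0# + b         ≈⟨ +-identityˡ b ⟩
    b              ∎

  inv : ∀ x → ¬ (x ≈ 0#) → Carrier
  inv x x≉0 = proj₁ (inverse x x≉0)

  inverseʳ : ∀ x (x≉0 : ¬ (x ≈ 0#)) → x * inv x x≉0 ≈ 1#
  inverseʳ x x≉0 = proj₂ (inverse x x≉0)

  cancel-zero : ∀ {x y} → ¬ (x ≈ 0#) → x * y ≈ 0# → y ≈ 0#
  cancel-zero {x} {y} x≉0 xy≈0 = begin
    y                      ≈⟨ *-identityˡ y ⟨
    1# * y                 ≈⟨ *-congʳ (trans (*-comm _ _) (inverseʳ x x≉0)) ⟨
    (inv x x≉0 * x) * y    ≈⟨ *-assoc _ _ _ ⟩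
    inv x x≉0 * (x * y)    ≈⟨ *-congˡ xy≈0 ⟩
    inv x x≉0 * 0#         ≈⟨ zeroʳ _ ⟩
    0#                     ∎

  cancel : ∀ {x y z} → ¬ (x ≈ 0#) → x * y ≈ x * z → y ≈ z
  cancel {x} {y} {z} x≉0 xy≈xz = difference≈0⇒≈ (cancel-zero x≉0 (begin
    x * (y - z)        ≈⟨ solve 3 (λ x y z → x :* (y :- z) := x :* y :- x :* z) refl x y z ⟩
    x * y - x * z      ≈⟨ difference≈0 xy≈xz ⟩
    0#                 ∎))

  nonzero-* : ∀ {x y} → ¬ (x ≈ 0#) → ¬ (y ≈ 0#) → ¬ (x * y ≈ 0#)
  nonzero-* x≉0 y≉0 xy≈0 = y≉0 (cancel-zero x≉0 xy≈0)

  nonzero-^ : ∀ {x} n → ¬ (x ≈ 0#) → ¬ (x ^ n ≈ 0#)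
  nonzero-^ zero    _   = 1≉0
  nonzero-^ (suc n) x≉0 = nonzero-* x≉0 (nonzero-^ n x≉0)

  zero-product : ∀ {x y} → x * y ≈ 0# → x ≈ 0# ⊎ y ≈ 0#
  zero-product {x} xy≈0 with x ≟ 0#
  ... | yes x≈0 = inj₁ x≈0
  ... | no  x≉0 = inj₂ (cancel-zero x≉0 xy≈0)

  square-zero : ∀ {x} → x * x ≈ 0# → x ≈ 0#
  square-zero {x} xx≈0 with zero-product xx≈0
  ... | inj₁ x≈0 = x≈0
  ... | inj₂ x≈0 = x≈0

  square-root-of-1 : ∀ {e} → e * e ≈ 1# → e ≈ 1# ⊎ e ≈ - 1#
  square-root-of-1 {e} ee≈1 with zero-product {e - 1#} {e + 1#} (begin
    (e - 1#) * (e + 1#)   ≈⟨ solve 1 (λ e → (e :- :1) :* (e :+ :1) := e :* e :- :1) refl e ⟩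
    e * e - 1#            ≈⟨ difference≈0 ee≈1 ⟩
    0#                    ∎)
  ... | inj₁ e-1≈0 = inj₁ (difference≈0⇒≈ e-1≈0)
  ... | inj₂ e+1≈0 = inj₂ (difference≈0⇒≈ (trans (+-congˡ (-‿involutive 1#)) e+1≈0))

  -- q · 1 = 0: translation by 1 permutes F, so Σ_y y = Σ_y (y + 1) = Σ_y y + q.
  order-vanishes : natR q ≈ 0#
  order-vanishes = begin
    natR q               ≈⟨ +-identityˡ _ ⟨
    0# + natR q          ≈⟨ +-congʳ (-‿inverseˡ S) ⟨
    (- S + S) + natR q   ≈⟨ +-assoc _ _ _ ⟩
    - S + (S + natR q)   ≈⟨ +-congˡ shifted-sum ⟨
    - S + S              ≈⟨ -‿inverseˡ S ⟩
    0#                   ∎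
    where
    shift : Carrier → Fin q → Fin q
    shift c i = from (to i + c)
    shift-inverse : ∀ c d → c + d ≈ 0# → ∀ i → shift d (shift c i) ≡ i
    shift-inverse c d c+d≈0 i = injective (begin
      to (shift d (shift c i))     ≈⟨ to-from _ ⟩
      to (shift c i) + d           ≈⟨ +-congʳ (to-from _) ⟩
      (to i + c) + d               ≈⟨ +-assoc _ _ _ ⟩
      to i + (c + d)               ≈⟨ +-congˡ c+d≈0 ⟩
      to i + 0#                    ≈⟨ +-identityʳ _ ⟩
      to i                         ∎)
    translation : Permutation q q
    translation = permutation (shift 1#) (shift (- 1#))
      (shift-inverse (- 1#) 1# (-‿inverseˡ 1#)) (shift-inverse 1# (- 1#) (-‿inverseʳ 1#))
    S : Carrier
    S = sum to
    shifted-sum : S ≈ S + natR q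
    shifted-sum = begin
      S                                    ≈⟨ sum-permute to translation ⟩
      sum {q} (λ i → to (shift 1# i))      ≈⟨ sum-cong-≋ {q} (λ i → to-from _) ⟩
      sum {q} (λ i → to i + 1#)            ≈⟨ ∑-distrib-+ {q} to (λ _ → 1#) ⟩
      S + sum {q} (λ _ → 1#)               ≡⟨ ≡.cong (S +_) (sum≡Σ q (λ _ → 1#)) ⟩
      S + Σ q (λ _ → 1#)                   ≈⟨ +-congˡ (Σ-1 q) ⟩
      S + natR q                           ∎

  characteristic : ∀ {p e} → q ≡ p ℕ.^ e → natR p ≈ 0#
  characteristic {p} {e} q≡pᵉ with natR p ≟ 0#
  ... | yes p≈0 = p≈0
  ... | no  p≉0 = ⊥-elim (nonzero-^ e p≉0 (begin
    natR p ^ e       ≈⟨ natR-^ p e ⟨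
    natR (p ℕ.^ e)   ≡⟨ ≡.cong natR q≡pᵉ ⟨
    natR q           ≈⟨ order-vanishes ⟩
    0#               ∎))
    where open import Data.Empty using (⊥-elim)

module PrimeSubfield (F : Field) {q : ℕ} (H : HasOrder F q) {p : ℕ} (pp : Prime p) where

  open import Data.Nat as ℕ using (zero; suc; _<_; _≤_; _%_; _/_)
  import Data.Nat.Properties as ℕP
  open import Data.Nat.Divisibility using (_∣_; divides; m%n≡0⇒n∣m)
  open import Data.Nat.DivMod using (m≡m%n+[m/n]*n; m%n<n)
  open import Data.Nat.Primality using (prime⇒nonZero)
  open import Data.Nat.Coprimality using (prime⇒coprime; coprime-Bézout)
  open import Data.Nat.GCD using (module Bézout)
  open import Data.Integer as ℤ using (ℤ)
  open import Data.Product using (∃; _,_)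
  open import Data.Sum using (_⊎_; inj₁; inj₂)
  open import Data.Empty using (⊥-elim)
  open import Relation.Nullary using (¬_; yes; no)
  open import Relation.Binary.PropositionalEquality as ≡ using (_≡_)
  open Field F using (1≉0)
  open FiniteField F H public
  open Solver

  instance
    p-nonZero : ℕ.NonZero p
    p-nonZero = prime⇒nonZero pp

  module WithCharacteristic (char : natR p ≈ 0#) where

    open Frobenius (Field.commRing F) pp using (fermat)

    natR-multiple : ∀ t → natR (t ℕ.* p) ≈ 0#
    natR-multiple t = trans (natR-* t p) (trans (*-congˡ char) (zeroʳ _))

    natR-mod : ∀ m → natR (m % p) ≈ natR m
    natR-mod m = sym (begin
      natR m                                  ≡⟨ ≡.cong natR (m≡m%n+[m/n]*n m p) ⟩
      natR (m % p ℕ.+ (m / p) ℕ.* p)          ≈⟨ natR-+ (m % p) ((m / p) ℕ.* p) ⟩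
      natR (m % p) + natR ((m / p) ℕ.* p)     ≈⟨ +-congˡ (natR-multiple (m / p)) ⟩
      natR (m % p) + 0#                       ≈⟨ +-identityʳ _ ⟩
      natR (m % p)                            ∎)

    -- 1, …, p-1 are nonzero: by Bézout, 1 + y·r = x·p (or the reverse), so
    -- r = 0 in F would give 1 = 0.
    natR-nonzero : ∀ r → 0 < r → r < p → ¬ (natR r ≈ 0#)
    natR-nonzero r 0<r r<p r≈0 with coprime-Bézout (prime⇒coprime pp {{ℕ.>-nonZero 0<r}} r<p)
    ... | Bézout.+- x y eq = 1≉0 (begin
      1#                        ≈⟨ one-plus-zero (y ℕ.* r) (multiple-of-r y) ⟨
      natR (1 ℕ.+ y ℕ.* r)      ≡⟨ ≡.cong natR eq ⟩
      natR (x ℕ.* p)            ≈⟨ natR-multiple x ⟩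
      0#                        ∎)
      where
      multiple-of-r : ∀ t → natR (t ℕ.* r) ≈ 0#
      multiple-of-r t = trans (natR-* t r) (trans (*-congˡ r≈0) (zeroʳ _))
      one-plus-zero : ∀ m → natR m ≈ 0# → natR (1 ℕ.+ m) ≈ 1#
      one-plus-zero m m≈0 = trans (natR-suc m) (trans (+-congˡ m≈0) (+-identityʳ 1#))
    ... | Bézout.-+ x y eq = 1≉0 (begin
      1#                        ≈⟨ one-plus-zero (x ℕ.* p) (natR-multiple x) ⟨
      natR (1 ℕ.+ x ℕ.* p)      ≡⟨ ≡.cong natR eq ⟩
      natR (y ℕ.* r)            ≈⟨ trans (natR-* y r) (trans (*-congˡ r≈0) (zeroʳ _)) ⟩
      0#                        ∎)
      where
      one-plus-zero : ∀ m → natR m ≈ 0# → natR (1 ℕ.+ m) ≈ 1#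
      one-plus-zero m m≈0 = trans (natR-suc m) (trans (+-congˡ m≈0) (+-identityʳ 1#))

    natR≈0⇒p∣ : ∀ m → natR m ≈ 0# → p ∣ m
    natR≈0⇒p∣ m m≈0 with m % p ℕ.≟ 0
    ... | yes m%p≡0 = m%n≡0⇒n∣m m p m%p≡0
    ... | no  m%p≢0 = ⊥-elim (natR-nonzero (m % p) (ℕP.n≢0⇒n>0 m%p≢0) (m%n<n m p)
                                           (trans (natR-mod m) m≈0))

    natR-∸ : ∀ {i j} → i ≤ j → natR (j ℕ.∸ i) ≈ natR j - natR i
    natR-∸ {i} {j} i≤j = begin
      natR (j ℕ.∸ i)                         ≈⟨ solve 2 (λ a b → a := (a :+ b) :- b) refl _ (natR i) ⟩
      (natR (j ℕ.∸ i) + natR i) - natR i     ≈⟨ +-congʳ (natR-+ (j ℕ.∸ i) i) ⟨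
      natR (j ℕ.∸ i ℕ.+ i) - natR i          ≡⟨ ≡.cong (λ n → natR n - natR i) (ℕP.m∸n+n≡m i≤j) ⟩
      natR j - natR i                        ∎

    natR-injective-≤ : ∀ {i j} → i ≤ j → j < p → natR i ≈ natR j → i ≡ j
    natR-injective-≤ {i} {j} i≤j j<p i≈j with j ℕ.∸ i ℕ.≟ 0
    ... | yes j∸i≡0 = ℕP.≤-antisym i≤j (ℕP.m∸n≡0⇒m≤n j∸i≡0)
    ... | no  j∸i≢0 = ⊥-elim (natR-nonzero (j ℕ.∸ i) (ℕP.n≢0⇒n>0 j∸i≢0)
        (ℕP.≤-<-trans (ℕP.m∸n≤m j i) j<p) (trans (natR-∸ i≤j) (difference≈0 (sym i≈j))))

    natR-injective : ∀ {i j} → i < p → j < p → natR i ≈ natR j → i ≡ j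
    natR-injective {i} {j} i<p j<p i≈j with ℕP.≤-total i j
    ... | inj₁ i≤j = natR-injective-≤ i≤j j<p i≈j
    ... | inj₂ j≤i = ≡.sym (natR-injective-≤ j≤i i<p (sym i≈j))

    In𝔽ₚ : Carrier → Set
    In𝔽ₚ y = ∃ λ m → y ≈ natR m

    𝔽ₚ-natR : ∀ m → In𝔽ₚ (natR m)
    𝔽ₚ-natR m = m , refl

    𝔽ₚ-cong : ∀ {a b} → a ≈ b → In𝔽ₚ a → In𝔽ₚ b
    𝔽ₚ-cong a≈b (m , a≈m) = m , trans (sym a≈b) a≈m

    𝔽ₚ-+ : ∀ {a b} → In𝔽ₚ a → In𝔽ₚ b → In𝔽ₚ (a + b)
    𝔽ₚ-+ (m , a≈m) (n , b≈n) = m ℕ.+ n , trans (+-cong a≈m b≈n) (sym (natR-+ m n))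

    𝔽ₚ-* : ∀ {a b} → In𝔽ₚ a → In𝔽ₚ b → In𝔽ₚ (a * b)
    𝔽ₚ-* (m , a≈m) (n , b≈n) = m ℕ.* n , trans (*-cong a≈m b≈n) (sym (natR-* m n))

    -- -m = (p - 1)·m, since p·m = 0
    𝔽ₚ-neg : ∀ {a} → In𝔽ₚ a → In𝔽ₚ (- a)
    𝔽ₚ-neg {a} (m , a≈m) = ℕ.pred p ℕ.* m , (begin
      - a                                          ≈⟨ -‿cong a≈m ⟩
      - natR m                                     ≈⟨ +-identityʳ _ ⟨
      - natR m + 0#                                ≈⟨ +-congˡ p·m≈0 ⟨
      - natR m + natR (suc (ℕ.pred p) ℕ.* m)       ≈⟨ +-congˡ (natR-+ m (ℕ.pred p ℕ.* m)) ⟩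
      - natR m + (natR m + natR (ℕ.pred p ℕ.* m))  ≈⟨ solve 2 (λ a b → :- a :+ (a :+ b) := b) refl _ _ ⟩
      natR (ℕ.pred p ℕ.* m)                        ∎)
      where
      p·m≈0 : natR (suc (ℕ.pred p) ℕ.* m) ≈ 0#
      p·m≈0 = begin
        natR (suc (ℕ.pred p) ℕ.* m)   ≡⟨ ≡.cong (λ n → natR (n ℕ.* m)) (ℕP.suc-pred p) ⟩
        natR (p ℕ.* m)                ≡⟨ ≡.cong natR (ℕP.*-comm p m) ⟩
        natR (m ℕ.* p)                ≈⟨ natR-multiple m ⟩
        0#                            ∎

    𝔽ₚ-- : ∀ {a b} → In𝔽ₚ a → In𝔽ₚ b → In𝔽ₚ (a - b)
    𝔽ₚ-- a∈ b∈ = 𝔽ₚ-+ a∈ (𝔽ₚ-neg b∈)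

    𝔽ₚ-^ : ∀ {a} n → In𝔽ₚ a → In𝔽ₚ (a ^ n)
    𝔽ₚ-^ zero    _  = 𝔽ₚ-natR 1
    𝔽ₚ-^ (suc n) a∈ = 𝔽ₚ-* a∈ (𝔽ₚ-^ n a∈)

    𝔽ₚ-natZ : ∀ i → In𝔽ₚ (natZ i)
    𝔽ₚ-natZ (ℤ.+ m)    = 𝔽ₚ-natR m
    𝔽ₚ-natZ ℤ.-[1+ m ] = 𝔽ₚ-neg (𝔽ₚ-natR (suc m))

    frobenius-fixed : ∀ {a} → In𝔽ₚ a → a ^ p ≈ a
    frobenius-fixed {a} (m , a≈m) = trans (^-congˡ p a≈m) (trans (fermat char m) (sym a≈m))

    natZ≈0⇒p∣ : ∀ i → natZ i ≈ 0# → p ∣ ℤ.∣ i ∣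
    natZ≈0⇒p∣ i i≈0 = natR≈0⇒p∣ ℤ.∣ i ∣ (begin
      natR ℤ.∣ i ∣                             ≈⟨ *-identityˡ _ ⟨
      1# * natR ℤ.∣ i ∣                        ≈⟨ *-congʳ (sgn² (ℤ.sign i)) ⟨
      (sgn (ℤ.sign i) * sgn (ℤ.sign i)) * natR ℤ.∣ i ∣   ≈⟨ *-assoc _ _ _ ⟩
      sgn (ℤ.sign i) * (sgn (ℤ.sign i) * natR ℤ.∣ i ∣)   ≈⟨ *-congˡ (natZ-sgn i) ⟨
      sgn (ℤ.sign i) * natZ i                  ≈⟨ *-congˡ i≈0 ⟩
      sgn (ℤ.sign i) * 0#                      ≈⟨ zeroʳ _ ⟩
      0#                                       ∎)
      where
      open import Data.Sign as Sign using (Sign)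
      sgn² : ∀ s → sgn s * sgn s ≈ 1#
      sgn² Sign.+ = *-identityˡ _
      sgn² Sign.- = solve 0 ((:- :1) :* (:- :1) := :1) refl

    p∣⇒natZ≈0 : ∀ i → p ∣ ℤ.∣ i ∣ → natZ i ≈ 0#
    p∣⇒natZ≈0 i (divides t eq) = begin
      natZ i                               ≈⟨ natZ-sgn i ⟩
      sgn (ℤ.sign i) * natR ℤ.∣ i ∣        ≡⟨ ≡.cong (λ n → sgn (ℤ.sign i) * natR n) eq ⟩
      sgn (ℤ.sign i) * natR (t ℕ.* p)      ≈⟨ *-congˡ (natR-multiple t) ⟩
      sgn (ℤ.sign i) * 0#                  ≈⟨ zeroʳ _ ⟩
      0#                                   ∎

    module OddCharacteristic (h : ℕ) (p≡2h+1 : p ≡ suc (h ℕ.+ h)) where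

      h≥1 : 1 ≤ h
      h≥1 = PrimeArithmetic.half-positive pp p≡2h+1

      fermat-little : ∀ {y} → In𝔽ₚ y → ¬ (y ≈ 0#) → y ^ (h ℕ.+ h) ≈ 1#
      fermat-little {y} y∈ y≉0 = cancel y≉0 (begin
        y * y ^ (h ℕ.+ h)  ≡⟨ ≡.cong (y ^_) p≡2h+1 ⟨
        y ^ p              ≈⟨ frobenius-fixed y∈ ⟩
        y                  ≈⟨ *-identityʳ y ⟨
        y * 1#             ∎)

      euler : ∀ {y} → In𝔽ₚ y → ¬ (y ≈ 0#) → y ^ h ≈ 1# ⊎ y ^ h ≈ - 1#
      euler {y} y∈ y≉0 = square-root-of-1 (trans (sym (^-homo-* y h h)) (fermat-little y∈ y≉0))

      -- a⁻¹ = a^(p-2), because a · a^(p-2) = a^(p-1) = 1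
      𝔽ₚ-inv : ∀ {a} → In𝔽ₚ a → (a≉0 : ¬ (a ≈ 0#)) → In𝔽ₚ (inv a a≉0)
      𝔽ₚ-inv {a} a∈ a≉0 = 𝔽ₚ-cong (sym inv≈power) (𝔽ₚ-^ m a∈)
        where
        instance
          2h-nonZero : ℕ.NonZero (h ℕ.+ h)
          2h-nonZero = ℕ.>-nonZero (ℕP.≤-trans h≥1 (ℕP.m≤m+n h h))
        m : ℕ
        m = ℕ.pred (h ℕ.+ h)
        a·aᵐ≈1 : a * a ^ m ≈ 1#
        a·aᵐ≈1 = trans (reflexive (≡.cong (a ^_) (ℕP.suc-pred (h ℕ.+ h)))) (fermat-little a∈ a≉0)
        inv≈power : inv a a≉0 ≈ a ^ m
        inv≈power = begin
          inv a a≉0                    ≈⟨ *-identityʳ _ ⟨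
          inv a a≉0 * 1#               ≈⟨ *-congˡ a·aᵐ≈1 ⟨
          inv a a≉0 * (a * a ^ m)      ≈⟨ *-assoc _ _ _ ⟨
          (inv a a≉0 * a) * a ^ m      ≈⟨ *-congʳ (trans (*-comm _ _) (inverseʳ a a≉0)) ⟩
          1# * a ^ m                   ≈⟨ *-identityˡ _ ⟩
          a ^ m                        ∎

      two half : Carrier
      two  = 1# + 1#
      half = natR (suc h)

      two·half≈1 : two * half ≈ 1#
      two·half≈1 = begin
        two * half                  ≈⟨ *-congʳ (natR-suc 1) ⟨
        natR 2 * natR (suc h)       ≈⟨ natR-* 2 (suc h) ⟨
        natR (2 ℕ.* suc h)          ≡⟨ ≡.cong natR 2[h+1]≡p+1 ⟩
        natR (suc p)                ≈⟨ natR-suc p ⟩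
        1# + natR p                 ≈⟨ +-congˡ char ⟩
        1# + 0#                     ≈⟨ +-identityʳ _ ⟩
        1#                          ∎
        where
        2[h+1]≡p+1 : 2 ℕ.* suc h ≡ suc p
        2[h+1]≡p+1 = ≡.trans (≡.cong suc (≡.trans (ℕP.+-suc h (h ℕ.+ 0))
                                           (≡.cong (λ n → suc (h ℕ.+ n)) (ℕP.+-identityʳ h))))
                             (≡.cong suc (≡.sym p≡2h+1))

      two≉0 : ¬ (two ≈ 0#)
      two≉0 two≈0 = 1≉0 (begin
        1#            ≈⟨ two·half≈1 ⟨
        two * half    ≈⟨ *-congʳ two≈0 ⟩
        0# * half     ≈⟨ zeroˡ _ ⟩
        0#            ∎)

      halve : ∀ {b c} → two * b ≈ c → b ≈ half * c
      halve {b} {c} 2b≈c = begin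
        b                   ≈⟨ *-identityˡ b ⟨
        1# * b              ≈⟨ *-congʳ two·half≈1 ⟨
        (two * half) * b    ≈⟨ solve 3 (λ t i b → (t :* i) :* b := i :* (t :* b)) refl two half b ⟩
        half * (two * b)    ≈⟨ *-congˡ 2b≈c ⟩
        half * c            ∎

      𝔽ₚ-two : In𝔽ₚ two
      𝔽ₚ-two = 𝔽ₚ-cong (natR-suc 1) (𝔽ₚ-natR 2)

      𝔽ₚ-half : In𝔽ₚ half
      𝔽ₚ-half = 𝔽ₚ-natR (suc h)

-- Power sums over the prime field: S t = Σ_{i<p} iᵗ vanishes for
-- 0 ≤ t ≤ p - 2.  Summing (i+1)^(m+1) - i^(m+1) over i < p telescopes to 0,
-- which gives the recurrence Σ_{t≤m} C(m+1,t) S t = 0, and the top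
-- coefficient C(m+1,m) = m + 1 is invertible while m + 1 < p.
module PowerSums (F : Field) {q : ℕ} (H : HasOrder F q) {p : ℕ} (pp : Prime p) where

  open import Data.Nat as ℕ using (zero; suc; _<_; _≤_; _∸_; z≤n; s≤s)
  import Data.Nat.Properties as ℕP
  open import Data.Nat.Combinatorics using (_C_; nCn≡1; nC1≡n; nCk≡nC[n∸k])
  open import Relation.Binary.PropositionalEquality as ≡ using (_≡_)
  open import Relation.Nullary using (yes; no)
  open PrimeSubfield F H pp
  open Sums (Field.commRing F)
  open Solver

  module _ (char : natR p ≈ 0#) where

    open WithCharacteristic char

    S : ℕ → Carrier
    S t = Σ p (λ i → natR i ^ t)

    increment : ∀ m y → (y + 1#) ^ suc m - y ^ suc m ≈ Σ (suc m) (λ t → natR (suc m C t) * y ^ t)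
    increment m y = begin
      (y + 1#) ^ suc m - y ^ suc m                     ≈⟨ +-congʳ (binomial (suc m) y 1#) ⟩
      Σ (suc (suc m)) (λ t → c t * (y ^ t * 1# ^ (suc m ∸ t))) - y ^ suc m
          ≈⟨ +-congʳ (Σ-cong (suc (suc m)) (λ t _ → *-congˡ {c t} (trans (*-congˡ {y ^ t} (1#^ (suc m ∸ t))) (*-identityʳ _)))) ⟩
      Σ (suc (suc m)) (λ t → c t * y ^ t) - y ^ suc m  ≈⟨ +-congʳ (Σ-last (suc m) (λ t → c t * y ^ t)) ⟩
      (Σ (suc m) (λ t → c t * y ^ t) + c (suc m) * y ^ suc m) - y ^ suc m
          ≈⟨ +-congʳ (+-congˡ (*-congʳ (reflexive (≡.cong natR (nCn≡1 (suc m)))))) ⟩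
      (Σ (suc m) (λ t → c t * y ^ t) + 1# * y ^ suc m) - y ^ suc m
          ≈⟨ solve 2 (λ a b → (a :+ :1 :* b) :- b := a) refl _ _ ⟩
      Σ (suc m) (λ t → c t * y ^ t)                    ∎
      where
      c : ℕ → Carrier
      c t = natR (suc m C t)
      1#^ : ∀ n → 1# ^ n ≈ 1#
      1#^ zero    = refl
      1#^ (suc n) = trans (*-identityˡ _) (1#^ n)

    recurrence : ∀ m → Σ (suc m) (λ t → natR (suc m C t) * S t) ≈ 0#
    recurrence m = begin
      Σ (suc m) (λ t → c t * S t)                             ≈⟨ Σ-cong (suc m) (λ t _ → sym (Σ-* p (c t) (λ i → natR i ^ t))) ⟩
      Σ (suc m) (λ t → Σ p (λ i → c t * natR i ^ t))          ≈⟨ Σ-comm p (suc m) (λ i t → c t * natR i ^ t) ⟨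
      Σ p (λ i → Σ (suc m) (λ t → c t * natR i ^ t))          ≈⟨ Σ-cong p (λ i _ → sym (increment m (natR i))) ⟩
      Σ p (λ i → (natR i + 1#) ^ suc m - natR i ^ suc m)      ≈⟨ Σ-cong p (λ i _ → +-congʳ (^-congˡ (suc m) (trans (+-comm _ _) (sym (natR-suc i))))) ⟩
      Σ p (λ i → natR (suc i) ^ suc m - natR i ^ suc m)       ≈⟨ Σ-telescope p (λ i → natR i ^ suc m) ⟩
      natR p ^ suc m - 0# ^ suc m                             ≈⟨ +-cong (trans (^-congˡ (suc m) char) (zeroˡ _)) (-‿cong (zeroˡ _)) ⟩
      0# - 0#                                                 ≈⟨ -‿inverseʳ _ ⟩
      0#                                                      ∎
      where
      c : ℕ → Carrier
      c t = natR (suc m C t)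

    private
      vanish-upto : ∀ m → suc m < p → ∀ t → t ≤ m → S t ≈ 0#
      vanish-upto zero    _   zero z≤n = trans (Σ-1 p) char
      vanish-upto (suc m) m<p t t≤m with t ℕ.≟ suc m
      ... | no  t≢m = vanish-upto m (ℕP.<-trans (ℕP.n<1+n _) m<p) t (ℕP.≤-pred (ℕP.≤∧≢⇒< t≤m t≢m))
      ... | yes ≡.refl = cancel-zero (natR-nonzero (suc (suc m)) (s≤s z≤n) m<p) (begin
        natR (suc (suc m)) * S (suc m)                  ≡⟨ ≡.cong (λ c → natR c * S (suc m)) (C-top (suc m)) ⟨
        c (suc m) * S (suc m)                           ≈⟨ +-identityˡ _ ⟨
        0# + c (suc m) * S (suc m)                      ≈⟨ +-congʳ lower ⟨
        Σ (suc m) (λ u → c u * S u) + c (suc m) * S (suc m)   ≈⟨ Σ-last (suc m) (λ u → c u * S u) ⟨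
        Σ (suc (suc m)) (λ u → c u * S u)               ≈⟨ recurrence (suc m) ⟩
        0#                                              ∎)
        where
        c : ℕ → Carrier
        c u = natR (suc (suc m) C u)
        C-top : ∀ n → suc n C n ≡ suc n
        C-top n = ≡.trans (nCk≡nC[n∸k] (ℕP.n≤1+n n))
                          (≡.trans (≡.cong (suc n C_) (ℕP.m+n∸n≡m 1 n)) (nC1≡n (suc n)))
        lower : Σ (suc m) (λ u → c u * S u) ≈ 0#
        lower = Σ-vanish (suc m) (λ u u≤m → trans (*-congˡ {c u} (vanish-upto m (ℕP.<-trans (ℕP.n<1+n _) m<p) u (ℕP.≤-pred u≤m))) (zeroʳ _))

    power-sums-vanish : ∀ t → suc t < p → S t ≈ 0#
    power-sums-vanish t t<p = vanish-upto t t<p t ℕP.≤-refl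

-- The quadratic algebra A = R[T]/(T² - T + x) over a commutative ring R.
-- An element a·T + b is stored as the pair (a , b); multiplication uses
-- T² = T - x.  Dickson polynomials live here: T is a root of
-- Y² - Y + x, so Tⁿ = aₙ T + bₙ with aₙ, bₙ given by the recurrence of
-- D_{n,k}(1,x).
module QuadraticAlgebra (R : CommutativeRing 0ℓ 0ℓ) (x : CommutativeRing.Carrier R) where

  open import Data.Product using (_×_; _,_)
  open import Relation.Binary.Structures using (IsEquivalence)
  open RingFacts R
  open Solver

  Pair : Set
  Pair = Carrier × Carrier

  infix  4 _≋_
  infixl 6 _⊕_
  infixl 7 _⊗_
  infix  8 ⊝_

  _≋_ : Pair → Pair → Set
  (a , b) ≋ (c , d) = (a ≈ c) × (b ≈ d)

  _⊕_ _⊗_ : Pair → Pair → Pair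
  (a , b) ⊕ (c , d) = (a + c , b + d)
  (a , b) ⊗ (c , d) = (a * c + a * d + b * c , b * d - x * (a * c))

  ⊝_ : Pair → Pair
  ⊝ (a , b) = (- a , - b)

  𝟘 𝟙 : Pair
  𝟘 = (0# , 0#)
  𝟙 = (0# , 1#)

  private
    ≋-isEquivalence : IsEquivalence _≋_
    ≋-isEquivalence = record
      { refl  = refl , refl
      ; sym   = λ { (e₁ , e₂) → sym e₁ , sym e₂ }
      ; trans = λ { (e₁ , e₂) (f₁ , f₂) → trans e₁ f₁ , trans e₂ f₂ } }

    ≋-trans : ∀ {u v w} → u ≋ v → v ≋ w → u ≋ w
    ≋-trans = IsEquivalence.trans ≋-isEquivalence

    ⊗-comm : ∀ u v → (u ⊗ v) ≋ (v ⊗ u)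
    ⊗-comm (a , b) (c , d) =
        solve 4 (λ a b c d → a :* c :+ a :* d :+ b :* c := c :* a :+ c :* b :+ d :* a) refl a b c d
      , solve 5 (λ a b c d x → b :* d :- x :* (a :* c) := d :* b :- x :* (c :* a)) refl a b c d x

    ⊗-identityˡ : ∀ u → (𝟙 ⊗ u) ≋ u
    ⊗-identityˡ (a , b) = solve 2 (λ a b → :0 :* a :+ :0 :* b :+ :1 :* a := a) refl a b
                        , solve 3 (λ a b x → :1 :* b :- x :* (:0 :* a) := b) refl a b x

    ⊗-assoc : ∀ u v w → ((u ⊗ v) ⊗ w) ≋ (u ⊗ (v ⊗ w))
    ⊗-assoc (a , b) (c , d) (e , f) =
        solve 7 (λ a b c d e f x →
           (a :* c :+ a :* d :+ b :* c) :* e :+ (a :* c :+ a :* d :+ b :* c) :* f :+ (b :* d :- x :* (a :* c)) :* e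
           := a :* (c :* e :+ c :* f :+ d :* e) :+ a :* (d :* f :- x :* (c :* e)) :+ b :* (c :* e :+ c :* f :+ d :* e)) refl a b c d e f x
      , solve 7 (λ a b c d e f x →
           (b :* d :- x :* (a :* c)) :* f :- x :* ((a :* c :+ a :* d :+ b :* c) :* e)
           := b :* (d :* f :- x :* (c :* e)) :- x :* (a :* (c :* e :+ c :* f :+ d :* e))) refl a b c d e f x

    ⊗-distribˡ : ∀ u v w → (u ⊗ (v ⊕ w)) ≋ ((u ⊗ v) ⊕ (u ⊗ w))
    ⊗-distribˡ (a , b) (c , d) (e , f) =
        solve 6 (λ a b c d e f → a :* (c :+ e) :+ a :* (d :+ f) :+ b :* (c :+ e)
                             := (a :* c :+ a :* d :+ b :* c) :+ (a :* e :+ a :* f :+ b :* e)) refl a b c d e f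
      , solve 7 (λ a b c d e f x → b :* (d :+ f) :- x :* (a :* (c :+ e))
                               := (b :* d :- x :* (a :* c)) :+ (b :* f :- x :* (a :* e))) refl a b c d e f x

  algebra : CommutativeRing 0ℓ 0ℓ
  algebra = record
    { Carrier = Pair ; _≈_ = _≋_ ; _+_ = _⊕_ ; _*_ = _⊗_ ; -_ = ⊝_ ; 0# = 𝟘 ; 1# = 𝟙
    ; isCommutativeRing = record
      { isRing = record
        { +-isAbelianGroup = record
          { isGroup = record
            { isMonoid = record
              { isSemigroup = record
                { isMagma = record
                  { isEquivalence = ≋-isEquivalence
                  ; ∙-cong = λ { (e₁ , e₂) (f₁ , f₂) → +-cong e₁ f₁ , +-cong e₂ f₂ } }
                ; assoc = λ { (a , b) (c , d) (e , f) → +-assoc a c e , +-assoc b d f } }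
              ; identity = (λ { (a , b) → +-identityˡ a , +-identityˡ b })
                         , (λ { (a , b) → +-identityʳ a , +-identityʳ b }) }
            ; inverse = (λ { (a , b) → -‿inverseˡ a , -‿inverseˡ b })
                      , (λ { (a , b) → -‿inverseʳ a , -‿inverseʳ b })
            ; ⁻¹-cong = λ { (e₁ , e₂) → -‿cong e₁ , -‿cong e₂ } }
          ; comm = λ { (a , b) (c , d) → +-comm a c , +-comm b d } }
        ; *-cong = λ { (e₁ , e₂) (f₁ , f₂) →
                       +-cong (+-cong (*-cong e₁ f₁) (*-cong e₁ f₂)) (*-cong e₂ f₁)
                     , +-cong (*-cong e₂ f₂) (-‿cong (*-congˡ (*-cong e₁ f₁))) }
        ; *-assoc = ⊗-assoc
        ; *-identity = ⊗-identityˡ , (λ u → ≋-trans (⊗-comm u 𝟙) (⊗-identityˡ u))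
        ; distrib = ⊗-distribˡ
                  , (λ u v w → ≋-trans (⊗-comm (v ⊕ w) u)
                       (≋-trans (⊗-distribˡ u v w)
                         (let (e₁ , e₂) = ⊗-comm u v ; (f₁ , f₂) = ⊗-comm u w
                          in +-cong e₁ f₁ , +-cong e₂ f₂))) }
      ; *-comm = ⊗-comm } }

  T : Pair
  T = (1# , 0#)

  ι : Carrier → Pair
  ι c = (0# , c)

  ι-cong : ∀ {a b} → a ≈ b → ι a ≋ ι b
  ι-cong a≈b = refl , a≈b

  ι-* : ∀ a b → (ι a ⊗ ι b) ≋ ι (a * b)
  ι-* a b = solve 2 (λ a b → :0 :* :0 :+ :0 :* b :+ a :* :0 := :0) refl a b
          , solve 3 (λ a b x → a :* b :- x :* (:0 :* :0) := a :* b) refl a b x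

  -- the conjugate root U = 1 - T of Y² - Y + x: T · U = x
  U : Pair
  U = (- 1# , 1#)

  T·U≋x : (T ⊗ U) ≋ ι x
  T·U≋x = solve 1 (λ x → :1 :* (:- :1) :+ :1 :* :1 :+ :0 :* (:- :1) := :0) refl x
        , solve 1 (λ x → :0 :* :1 :- x :* (:1 :* (:- :1)) := x) refl x

-- D_{n,k}(1,x) as a linear functional of Tⁿ in A = F[T]/(T² - T + x):
-- writing Φ_m(a·T + b) = a·D_{m+1} + b·D_m, the recurrence
-- D_{m+2} = D_{m+1} - x·D_m says exactly Φ_m(u·T) = Φ_{m+1}(u), hence
-- D_n = Φ_0(Tⁿ).
module DicksonTrace (F : Field) (k : ℕ) (x : Field.Carrier F) where

  open import Data.Nat as ℕ using (zero; suc)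
  import Data.Nat.Properties as ℕP
  open import Data.Product using (_,_)
  open import Relation.Binary.PropositionalEquality as ≡ using (_≡_)
  open RingFacts (Field.commRing F)
  open Solver
  open QuadraticAlgebra (Field.commRing F) x public
  module A = RingFacts algebra

  Dₓ : ℕ → Carrier
  Dₓ n = D F k n x

  κ : Carrier
  κ = Dₓ 0

  Φ : ℕ → Pair → Carrier
  Φ m (a , b) = a * Dₓ (suc m) + b * Dₓ m

  Φ-cong : ∀ m {u v} → u ≋ v → Φ m u ≈ Φ m v
  Φ-cong m (e₁ , e₂) = +-cong (*-congʳ e₁) (*-congʳ e₂)

  Φ-shift : ∀ m u → Φ m (u ⊗ T) ≈ Φ (suc m) u
  Φ-shift m (a , b) = solve 5 (λ a b x d₁ d₀ →
      (a :* :1 :+ a :* :0 :+ b :* :1) :* d₁ :+ (b :* :0 :- x :* (a :* :1)) :* d₀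
      := a :* (d₁ :- x :* d₀) :+ b :* d₁) refl a b x (Dₓ (suc m)) (Dₓ m)

  Φ-power : ∀ n m → Φ m (T A.^ n) ≈ Dₓ (n ℕ.+ m)
  Φ-power zero    m = trans (+-cong (zeroˡ _) (*-identityˡ _)) (+-identityˡ _)
  Φ-power (suc n) m = begin
    Φ m (T ⊗ (T A.^ n))     ≈⟨ Φ-cong m (A.*-comm T (T A.^ n)) ⟩
    Φ m ((T A.^ n) ⊗ T)     ≈⟨ Φ-shift m (T A.^ n) ⟩
    Φ (suc m) (T A.^ n)     ≈⟨ Φ-power n (suc m) ⟩
    Dₓ (n ℕ.+ suc m)        ≡⟨ ≡.cong Dₓ (ℕP.+-suc n m) ⟩
    Dₓ (suc n ℕ.+ m)        ∎

  D-trace : ∀ n → Dₓ n ≈ Φ 0 (T A.^ n)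
  D-trace n = sym (trans (Φ-power n 0) (reflexive (≡.cong Dₓ (ℕP.+-identityʳ n))))

  Φ-scalar : ∀ c u → Φ 0 (ι c ⊗ u) ≈ c * Φ 0 u
  Φ-scalar c (a , b) = solve 6 (λ c a b d₁ d₀ x →
      (:0 :* a :+ :0 :* b :+ c :* a) :* d₁ :+ (c :* b :- x :* (:0 :* a)) :* d₀
      := c :* (a :* d₁ :+ b :* d₀)) refl c a b (Dₓ 1) κ x

  Φ-U : Φ 0 U ≈ κ - 1#
  Φ-U = solve 1 (λ κ → (:- :1) :* :1 :+ :1 :* κ := κ :- :1) refl κ

-- With
-- d = 1 - 4x and ε = d^((p-1)/2), the element s = 2T - 1 has s² = d, so
-- sᵖ = s·ε; since the Frobenius is additive and fixes 𝔽ₚ this gives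
-- Tᵖ = ε·T + (1 - ε)/2, and iterating, T^(pˡ) = εˡ·T + (1 - εˡ)/2.
module FrobeniusOnAlgebra (F : Field) {q : ℕ} (H : HasOrder F q) {p : ℕ} (pp : Prime p)
    (h : ℕ) (p≡2h+1 : OddWith p h) where

  open import Data.Nat as ℕ using (zero; suc)
  import Data.Nat.Properties as ℕP
  open import Data.Product using (_,_; proj₁; proj₂)
  open import Relation.Binary.PropositionalEquality as ≡ using (_≡_)
  open PrimeSubfield F H pp

  module Over (char : natR p ≈ 0#) where

    open WithCharacteristic char
    open OddCharacteristic h p≡2h+1

    -- d(x) = 1 - 4x is the discriminant of Y² - Y + x
    d : Carrier → Carrier
    d x = 1# - (two * two) * x

    -- ε(x) = d(x)^h, which is 0 or ±1 on 𝔽ₚ (Euler's criterion)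
    ε : Carrier → Carrier
    ε x = d x ^ h

    module AtPoint (x : Carrier) (x∈ : In𝔽ₚ x) where

      open QuadraticAlgebra commRing x
      module A = RingFacts algebra
      open Solver

      f : Carrier → Pair
      f e = (e , half * (1# - e))

      f-cong : ∀ {a b} → a ≈ b → f a ≋ f b
      f-cong a≈b = a≈b , *-congˡ (+-congˡ (-‿cong a≈b))

      private
        infixr 4 _⟫_
        _⟫_ : ∀ {u v w} → u ≋ v → v ≋ w → u ≋ w
        _⟫_ = A.trans

      ι-^ : ∀ c n → (ι c A.^ n) ≋ ι (c ^ n)
      ι-^ c zero    = A.refl
      ι-^ c (suc n) = A.*-congˡ (ι-^ c n) ⟫ ι-* c (c ^ n)

      A-natR : ∀ n → A.natR n ≋ ι (natR n)
      A-natR zero          = A.refl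
      A-natR (suc zero)    = A.refl
      A-natR (suc (suc n)) = A.+-congˡ (A-natR (suc n)) ⟫ (+-identityˡ 0# , refl)

      A-frobenius : ∀ u v → ((u ⊕ v) A.^ p) ≋ ((u A.^ p) ⊕ (v A.^ p))
      A-frobenius = Frobenius.frobenius algebra pp (A-natR p ⟫ (refl , char))

      ι-fixed : ∀ {c} → In𝔽ₚ c → (ι c A.^ p) ≋ ι c
      ι-fixed {c} c∈ = ι-^ c p ⟫ ι-cong (frobenius-fixed c∈)

      s : Pair
      s = (two , - 1#)

      s-decomposition : s ≋ ((ι two ⊗ T) ⊕ ι (- 1#))
      s-decomposition = solve 1 (λ t → t := (:0 :* :1 :+ :0 :* :0 :+ t :* :1) :+ :0) refl two
                      , solve 2 (λ t x → :- :1 := (t :* :0 :- x :* (:0 :* :1)) :+ :- :1) refl two x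

      s² : (s ⊗ s) ≋ ι (d x)
      s² = solve 0 (:2 :* :2 :+ :2 :* (:- :1) :+ (:- :1) :* :2 := :0) refl
         , solve 2 (λ t x → (:- :1) :* (:- :1) :- x :* (t :* t) := :1 :- (t :* t) :* x) refl two x

      sᵖ : (s A.^ p) ≋ (s ⊗ ι (ε x))
      sᵖ = ≡.subst (λ n → (s A.^ n) ≋ (s ⊗ ι (ε x))) (≡.sym p≡2h+1)
             (A.*-congˡ (A.^-homo-* s h h ⟫ A.sym (A.^-distrib-* s s h) ⟫ A.^-congˡ h s² ⟫ ι-^ (d x) h))

      d∈ : In𝔽ₚ (d x)
      d∈ = 𝔽ₚ-- (𝔽ₚ-natR 1) (𝔽ₚ-* (𝔽ₚ-* 𝔽ₚ-two 𝔽ₚ-two) x∈)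

      ε∈ : In𝔽ₚ (ε x)
      ε∈ = 𝔽ₚ-^ h d∈

      -- Tᵖ = f(ε): apply the Frobenius to s = 2T - 1 and compare coordinates
      Tᵖ : (T A.^ p) ≋ f (ε x)
      Tᵖ = a≈ε , b≈
        where
        a b : Carrier
        a = proj₁ (T A.^ p)
        b = proj₂ (T A.^ p)
        2Tᵖ-1≋sε : ((ι two ⊗ (T A.^ p)) ⊕ ι (- 1#)) ≋ (s ⊗ ι (ε x))
        2Tᵖ-1≋sε =
          A.sym (A.+-cong (A.*-congʳ (ι-fixed 𝔽ₚ-two)) (ι-fixed (𝔽ₚ-neg (𝔽ₚ-natR 1))))
          ⟫ A.sym (A.+-congʳ (A.^-distrib-* (ι two) T p))
          ⟫ A.sym (A-frobenius (ι two ⊗ T) (ι (- 1#)))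
          ⟫ A.sym (A.^-congˡ p s-decomposition)
          ⟫ sᵖ
        a≈ε : a ≈ ε x
        a≈ε = cancel two≉0 (begin
          two * a    ≈⟨ solve 3 (λ t a b → t :* a := (:0 :* a :+ :0 :* b :+ t :* a) :+ :0) refl two a b ⟩
          _          ≈⟨ proj₁ 2Tᵖ-1≋sε ⟩
          _          ≈⟨ solve 2 (λ t e → t :* :0 :+ t :* e :+ (:- :1) :* :0 := t :* e) refl two (ε x) ⟩
          two * ε x  ∎)
        b≈ : b ≈ half * (1# - ε x)
        b≈ = halve (begin
          two * b    ≈⟨ solve 4 (λ t a b x → t :* b := ((t :* b :- x :* (:0 :* a)) :+ :- :1) :+ :1) refl two a b x ⟩
          _ + 1#     ≈⟨ +-congʳ (proj₂ 2Tᵖ-1≋sε) ⟩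
          _          ≈⟨ solve 3 (λ t e x → ((:- :1) :* e :- x :* (t :* :0)) :+ :1 := :1 :- e) refl two (ε x) x ⟩
          1# - ε x   ∎)

      f-decomposition : ∀ e → f e ≋ ((ι e ⊗ T) ⊕ ι (half * (1# - e)))
      f-decomposition e = solve 1 (λ e → e := (:0 :* :1 :+ :0 :* :0 :+ e :* :1) :+ :0) refl e
                        , solve 3 (λ e c x → c := (e :* :0 :- x :* (:0 :* :1)) :+ c) refl e (half * (1# - e)) x

      T^pˡ : ∀ l → (T A.^ (p ℕ.^ l)) ≋ f (ε x ^ l)
      T^pˡ zero = solve 1 (λ x → :1 :* :0 :+ :1 :* :1 :+ :0 :* :0 := :1) refl x
                , solve 2 (λ x i → :0 :* :1 :- x :* (:1 :* :0) := i :* (:1 :- :1)) refl x half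
      T^pˡ (suc l) =
        A.reflexive (≡.cong (T A.^_) (ℕP.*-comm p (p ℕ.^ l)))
        ⟫ A.sym (A.^-assocʳ T (p ℕ.^ l) p)
        ⟫ A.^-congˡ p (T^pˡ l ⟫ f-decomposition e)
        ⟫ A-frobenius (ι e ⊗ T) (ι c)
        ⟫ A.+-cong (A.^-distrib-* (ι e) T p) (ι-fixed c∈)
        ⟫ A.+-congʳ (A.*-cong (ι-fixed e∈) Tᵖ)
        ⟫ next
        where
        e c : Carrier
        e = ε x ^ l
        c = half * (1# - e)
        e∈ : In𝔽ₚ e
        e∈ = 𝔽ₚ-^ l ε∈
        c∈ : In𝔽ₚ c
        c∈ = 𝔽ₚ-* 𝔽ₚ-half (𝔽ₚ-- (𝔽ₚ-natR 1) e∈)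
        next : ((ι e ⊗ f (ε x)) ⊕ ι c) ≋ f (ε x ^ suc l)
        next = solve 3 (λ e ε i → (:0 :* ε :+ :0 :* (i :* (:1 :- ε)) :+ e :* ε) :+ :0 := ε :* e) refl e (ε x) half
             , solve 4 (λ e ε i x → (e :* (i :* (:1 :- ε)) :- x :* (:0 :* ε)) :+ i :* (:1 :- e)
                                 := i :* (:1 :- ε :* e)) refl e (ε x) half x

-- D_{N,k}(1,x) for N = Σ_{l ∈ ls} pˡ and x ∈ 𝔽ₚ: since T^N = ∏ T^(pˡ)
-- = ∏ f(εˡ), the value depends only on ε = ε(x) ∈ {0, ±1} and on how many
-- exponents are zero or odd.
module DicksonAtPrimePoints (F : Field) {q : ℕ} (H : HasOrder F q) {p : ℕ} (pp : Prime p)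
    (h : ℕ) (p≡2h+1 : OddWith p h) where

  open import Data.Nat as ℕ using (zero; suc)
  open import Data.Bool using (true; false; if_then_else_)
  open import Data.List using (List; _∷_; []; map; length)
  open import Data.Nat.ListAction using (sum)
  open import Data.Product using (_,_)
  open import Relation.Binary.PropositionalEquality as ≡ using (_≡_)
  open ExponentCounting using (count; is-zero; is-odd)
  open PrimeSubfield F H pp

  N : List ℕ → ℕ
  N ls = sum (map (p ℕ.^_) ls)

  module _ (char : natR p ≈ 0#) (k : ℕ) (x : Carrier) (x∈ : WithCharacteristic.In𝔽ₚ char x) where

    open WithCharacteristic char
    open OddCharacteristic h p≡2h+1
    module Frob = FrobeniusOnAlgebra.Over F H pp h p≡2h+1 char
    open Frob using (d; ε)
    open Frob.AtPoint x x∈ using (f; f-cong; ι-^; T^pˡ)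
    open DicksonTrace F k x
    open Solver

    -- T^N = ∏ T^(pˡ) = ∏ f(εˡ)
    D-at-N : ∀ ls → Dₓ (N ls) ≈ Φ 0 (A.∏ (map (λ l → f (ε x ^ l)) ls))
    D-at-N ls = trans (D-trace (N ls)) (Φ-cong 0 (A.trans (A.^-sum T (map (p ℕ.^_) ls)) (∏-map ls)))
      where
      ∏-map : ∀ ls → A.∏ (map (T A.^_) (map (p ℕ.^_) ls)) ≋ A.∏ (map (λ l → f (ε x ^ l)) ls)
      ∏-map []       = A.refl
      ∏-map (l ∷ ls) = A.*-cong (T^pˡ l) (∏-map ls)

    f-1 : f 1# ≋ T
    f-1 = refl , trans (*-congˡ (-‿inverseʳ 1#)) (zeroʳ _)

    f-0 : f 0# ≋ ι half
    f-0 = refl , trans (*-congˡ (trans (+-congˡ -0#≈0#) (+-identityʳ _))) (*-identityʳ _)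

    f-−1 : f (- 1#) ≋ U
    f-−1 = refl , (begin
      half * (1# - - 1#)   ≈⟨ *-congˡ (+-congˡ (-‿involutive 1#)) ⟩
      half * two           ≈⟨ *-comm _ _ ⟩
      two * half           ≈⟨ two·half≈1 ⟩
      1#                   ∎)

    Φ-scaled-power : ∀ c j → Φ 0 (ι c ⊗ T A.^ j) ≈ c * Dₓ j
    Φ-scaled-power c j = trans (Φ-scalar c (T A.^ j)) (*-congˡ (sym (D-trace j)))

    -- Case d(x) = 0 (x = 1/4): ε = 0, so εˡ is 1 for l = 0 and 0 otherwise.
    D-at-N-singular : d x ≈ 0# → ∀ ls →
      Dₓ (N ls) ≈ half ^ (length ls ℕ.∸ count is-zero ls) * Dₓ (count is-zero ls)
    D-at-N-singular d≈0 ls = begin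
      Dₓ (N ls)                                ≈⟨ D-at-N ls ⟩
      Φ 0 (A.∏ (map (λ l → f (ε x ^ l)) ls))   ≈⟨ Φ-cong 0 (A.∏-select is-zero T (ι half) (λ l → f (ε x ^ l)) select ls) ⟩
      Φ 0 (T A.^ J ⊗ ι half A.^ m)             ≈⟨ Φ-cong 0 (A.trans (A.*-comm _ _) (A.*-congʳ (ι-^ half m))) ⟩
      Φ 0 (ι (half ^ m) ⊗ T A.^ J)             ≈⟨ Φ-scaled-power (half ^ m) J ⟩
      half ^ m * Dₓ J                          ∎
      where
      J m : ℕ
      J = count is-zero ls
      m = length ls ℕ.∸ J
      ε≈0 : ε x ≈ 0#
      ε≈0 = power-of-zero h h≥1 d≈0
      select : ∀ l → f (ε x ^ l) ≋ (if is-zero l then T else ι half)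
      select zero    = f-1
      select (suc l) = A.trans (f-cong (power-of-zero (suc l) (ℕ.s≤s ℕ.z≤n) ε≈0)) f-0

    -- Case ε(x) = 1: every T^(pˡ) equals T.
    D-at-N-residue : ε x ≈ 1# → ∀ ls → Dₓ (N ls) ≈ Dₓ (length ls)
    D-at-N-residue ε≈1 ls = begin
      Dₓ (N ls)                                ≈⟨ D-at-N ls ⟩
      Φ 0 (A.∏ (map (λ l → f (ε x ^ l)) ls))   ≈⟨ Φ-cong 0 (A.∏-constant T (λ l → f (ε x ^ l)) select ls) ⟩
      Φ 0 (T A.^ length ls)                    ≈⟨ D-trace (length ls) ⟨
      Dₓ (length ls)                           ∎
      where
      1^ : ∀ l → 1# ^ l ≈ 1#
      1^ zero    = refl
      1^ (suc l) = trans (*-identityˡ _) (1^ l)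
      select : ∀ l → f (ε x ^ l) ≋ T
      select l = A.trans (f-cong (trans (^-congˡ l ε≈1) (1^ l))) f-1

    -- Case ε(x) = -1: T^(pˡ) is T or U according to the parity of l.
    D-at-N-nonresidue : ε x ≈ - 1# → ∀ ls →
      Dₓ (N ls) ≈ Φ 0 (U A.^ count is-odd ls ⊗ T A.^ (length ls ℕ.∸ count is-odd ls))
    D-at-N-nonresidue ε≈-1 ls = trans (D-at-N ls)
      (Φ-cong 0 (A.∏-select is-odd U T (λ l → f (ε x ^ l)) select ls))
      where
      sign : ∀ l → (- 1#) ^ l ≈ (if is-odd l then - 1# else 1#)
      sign zero = refl
      sign (suc l) with is-odd l | sign l
      ... | true  | ih = trans (*-congˡ ih) (solve 0 ((:- :1) :* (:- :1) := :1) refl)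
      ... | false | ih = trans (*-congˡ ih) (*-identityʳ _)
      f-sign : ∀ b → f (if b then - 1# else 1#) ≋ (if b then U else T)
      f-sign true  = f-−1
      f-sign false = f-1
      select : ∀ l → f (ε x ^ l) ≋ (if is-odd l then U else T)
      select l = A.trans (f-cong (trans (^-congˡ l ε≈-1) (sign l))) (f-sign (is-odd l))

-- Let G permute 𝔽ₚ (p = 2h + 1, h ≥ 3)
-- with G(0) = c, G(i) = u₀ + u₁ i on the nonzero squares (iʰ = 1) and
-- G(i) = v₀ + v₁ i on the non-squares (iʰ = -1).  Comparing
-- Σ_i G(i)ˢ = Σ_i iˢ = 0 (s = 1, 2) with the same sum computed from the
-- two linear pieces gives 2c = u₀ + v₀ and 2c² = u₀² + v₀², hence u₀ = v₀.
module TwoLinePermutations (F : Field) {q : ℕ} (H : HasOrder F q) {p : ℕ} (pp : Prime p)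
    (h : ℕ) (p≡2h+1 : OddWith p h) where

  open import Data.Nat as ℕ using (zero; suc; _<_; _≤_; _%_; z≤n; s≤s)
  import Data.Nat.Properties as ℕP
  open import Data.Nat.DivMod using (m%n<n)
  open import Data.Fin as Fin using (Fin; toℕ; fromℕ<)
  import Data.Fin.Properties as FinP
  open import Data.Product using (∃; ∃₂; _,_; proj₁; proj₂)
  open import Data.Sum using (inj₁; inj₂)
  open import Relation.Binary.PropositionalEquality as ≡ using (_≡_)
  open PrimeSubfield F H pp
  open Sums commRing
  open PowerSums F H pp using (S; power-sums-vanish)
  open Solver

  module Over (char : natR p ≈ 0#) where

    open WithCharacteristic char
    open OddCharacteristic h p≡2h+1

    permuted-power-sum : (G : ℕ → Carrier) → (∀ i → In𝔽ₚ (G i)) →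
                         (∀ {i j} → i < p → j < p → G i ≈ G j → i ≡ j) →
                         ∀ s → Σ p (λ i → G i ^ s) ≈ S char s
    permuted-power-sum G G∈ G-inj s = begin
      Σ p (λ i → G i ^ s)                        ≡⟨ sum≡Σ p (λ i → G i ^ s) ⟨
      sum {p} (λ i → G (toℕ i) ^ s)              ≈⟨ sum-cong-≋ {p} (λ i → ^-congˡ s (sym (σ-value i))) ⟩
      sum {p} (λ i → natR (toℕ (σ i)) ^ s)       ≈⟨ Σ-reindex p σ σ-injective (λ n → natR n ^ s) ⟩
      S char s                                   ∎
      where
      open import Algebra.Properties.CommutativeMonoid.Sum +-commutativeMonoid using (sum; sum-cong-≋)
      σ : Fin p → Fin p
      σ i = fromℕ< (m%n<n (proj₁ (G∈ (toℕ i))) p)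
      σ-value : ∀ i → natR (toℕ (σ i)) ≈ G (toℕ i)
      σ-value i = begin
        natR (toℕ (σ i))        ≡⟨ ≡.cong natR (FinP.toℕ-fromℕ< (m%n<n m p)) ⟩
        natR (m % p)            ≈⟨ natR-mod m ⟩
        natR m                  ≈⟨ proj₂ (G∈ (toℕ i)) ⟨
        G (toℕ i)               ∎
        where
        m : ℕ
        m = proj₁ (G∈ (toℕ i))
      σ-injective : ∀ {i j} → σ i ≡ σ j → i ≡ j
      σ-injective {i} {j} σi≡σj = FinP.toℕ-injective (G-inj (FinP.toℕ<n i) (FinP.toℕ<n j)
        (trans (sym (σ-value i)) (trans (reflexive (≡.cong (λ k → natR (toℕ k)) σi≡σj)) (σ-value j))))

    Quadratic : (Carrier → Carrier) → Set
    Quadratic P = ∃₂ λ a₀ a₁ → ∃ λ a₂ → ∀ y → P y ≈ a₀ + a₁ * y + a₂ * (y * y)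

    quadratic-+ : ∀ {P Q} → Quadratic P → Quadratic Q → Quadratic (λ y → P y + Q y)
    quadratic-+ (a₀ , a₁ , a₂ , P≈) (b₀ , b₁ , b₂ , Q≈) = a₀ + b₀ , a₁ + b₁ , a₂ + b₂ , λ y →
      trans (+-cong (P≈ y) (Q≈ y)) (solve 8 (λ a₀ a₁ a₂ b₀ b₁ b₂ y y² →
        (a₀ :+ a₁ :* y :+ a₂ :* y²) :+ (b₀ :+ b₁ :* y :+ b₂ :* y²)
        := (a₀ :+ b₀) :+ (a₁ :+ b₁) :* y :+ (a₂ :+ b₂) :* y²) refl a₀ a₁ a₂ b₀ b₁ b₂ y (y * y))

    quadratic-− : ∀ {P Q} → Quadratic P → Quadratic Q → Quadratic (λ y → P y - Q y)
    quadratic-− (a₀ , a₁ , a₂ , P≈) (b₀ , b₁ , b₂ , Q≈) = a₀ - b₀ , a₁ - b₁ , a₂ - b₂ , λ y →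
      trans (+-cong (P≈ y) (-‿cong (Q≈ y))) (solve 8 (λ a₀ a₁ a₂ b₀ b₁ b₂ y y² →
        (a₀ :+ a₁ :* y :+ a₂ :* y²) :- (b₀ :+ b₁ :* y :+ b₂ :* y²)
        := (a₀ :- b₀) :+ (a₁ :- b₁) :* y :+ (a₂ :- b₂) :* y²) refl a₀ a₁ a₂ b₀ b₁ b₂ y (y * y))

    line-power : ∀ a b s → s ≤ 2 → Quadratic (λ y → (a + b * y) ^ s)
    line-power a b zero _ = 1# , 0# , 0# , λ y →
      solve 1 (λ y → :1 := :1 :+ :0 :* y :+ :0 :* (y :* y)) refl y
    line-power a b (suc zero) _ = a , b , 0# , λ y →
      solve 3 (λ a b y → (a :+ b :* y) :* :1 := a :+ b :* y :+ :0 :* (y :* y)) refl a b y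
    line-power a b (suc (suc zero)) _ = a * a , two * (a * b) , b * b , λ y →
      solve 3 (λ a b y → (a :+ b :* y) :* ((a :+ b :* y) :* :1)
                       := a :* a :+ :2 :* (a :* b) :* y :+ b :* b :* (y :* y)) refl a b y
    line-power a b (suc (suc (suc s))) (s≤s (s≤s ()))

    quadratic-moment : ∀ P → Quadratic P → ∀ t → suc (suc (suc t)) < p →
                       Σ p (λ i → P (natR i) * natR i ^ t) ≈ 0#
    quadratic-moment P (a₀ , a₁ , a₂ , P≈) t t+3<p = begin
      Σ p (λ i → P (natR i) * natR i ^ t)
        ≈⟨ Σ-cong p (λ i _ → trans (*-congʳ (P≈ (natR i))) (expand (natR i))) ⟩
      Σ p (λ i → a₀ * natR i ^ t + a₁ * natR i ^ suc t + a₂ * natR i ^ suc (suc t))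
        ≈⟨ trans (Σ-+ p _ _) (+-congʳ (Σ-+ p _ _)) ⟩
      (Σ p (λ i → a₀ * natR i ^ t) + Σ p (λ i → a₁ * natR i ^ suc t)) + Σ p (λ i → a₂ * natR i ^ suc (suc t))
        ≈⟨ +-cong (+-cong (moment a₀ t 2+) (moment a₁ (suc t) 1+)) (moment a₂ (suc (suc t)) t+3<p) ⟩
      (0# + 0#) + 0#
        ≈⟨ trans (+-identityʳ _) (+-identityʳ _) ⟩
      0#  ∎
      where
      expand : ∀ y → (a₀ + a₁ * y + a₂ * (y * y)) * y ^ t ≈ a₀ * y ^ t + a₁ * y ^ suc t + a₂ * y ^ suc (suc t)
      expand y = solve 5 (λ a₀ a₁ a₂ y yᵗ → (a₀ :+ a₁ :* y :+ a₂ :* (y :* y)) :* yᵗ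
                                          := a₀ :* yᵗ :+ a₁ :* (y :* yᵗ) :+ a₂ :* (y :* (y :* yᵗ)))
                         refl a₀ a₁ a₂ y (y ^ t)
      moment : ∀ a u → suc u < p → Σ p (λ i → a * natR i ^ u) ≈ 0#
      moment a u u+1<p = trans (Σ-* p a (λ i → natR i ^ u)) (trans (*-congˡ (power-sums-vanish char u u+1<p)) (zeroʳ a))
      1+ : suc (suc t) < p
      1+ = ℕP.<-trans (ℕP.n<1+n _) t+3<p
      2+ : suc t < p
      2+ = ℕP.<-trans (ℕP.n<1+n _) 1+

    module _ (h≥3 : 3 ≤ h) (G : ℕ → Carrier) (G∈ : ∀ i → In𝔽ₚ (G i))
             (G-injective : ∀ {i j} → i < p → j < p → G i ≈ G j → i ≡ j)
             (u₀ u₁ v₀ v₁ c : Carrier) (G-zero : G 0 ≈ c)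
             (G-square : ∀ i → 0 < i → i < p → natR i ^ h ≈ 1# → G i ≈ u₀ + u₁ * natR i)
             (G-nonsquare : ∀ i → 0 < i → i < p → natR i ^ h ≈ - 1# → G i ≈ v₀ + v₁ * natR i)
             where

      private
        L M : Carrier → Carrier
        L y = u₀ + u₁ * y
        M y = v₀ + v₁ * y

        -- W s y interpolates: it is L(y)ˢ on squares and M(y)ˢ on non-squares
        W : ℕ → Carrier → Carrier
        W s y = half * ((L y ^ s + M y ^ s) * y ^ 0 + (L y ^ s - M y ^ s) * y ^ h)

        W-square : ∀ s y → y ^ h ≈ 1# → W s y ≈ L y ^ s
        W-square s y yʰ≈1 = begin
          W s y                                              ≈⟨ *-congˡ (+-congˡ (*-congˡ yʰ≈1)) ⟩
          half * ((L y ^ s + M y ^ s) * 1# + (L y ^ s - M y ^ s) * 1#)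
            ≈⟨ solve 3 (λ i a b → i :* ((a :+ b) :* :1 :+ (a :- b) :* :1) := (:2 :* i) :* a) refl half _ _ ⟩
          two * half * L y ^ s                              ≈⟨ *-congʳ two·half≈1 ⟩
          1# * L y ^ s                                       ≈⟨ *-identityˡ _ ⟩
          L y ^ s                                            ∎

        W-nonsquare : ∀ s y → y ^ h ≈ - 1# → W s y ≈ M y ^ s
        W-nonsquare s y yʰ≈-1 = begin
          W s y                                              ≈⟨ *-congˡ (+-congˡ (*-congˡ yʰ≈-1)) ⟩
          half * ((L y ^ s + M y ^ s) * 1# + (L y ^ s - M y ^ s) * - 1#)
            ≈⟨ solve 3 (λ i a b → i :* ((a :+ b) :* :1 :+ (a :- b) :* (:- :1)) := (:2 :* i) :* b) refl half _ _ ⟩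
          two * half * M y ^ s                              ≈⟨ *-congʳ two·half≈1 ⟩
          1# * M y ^ s                                       ≈⟨ *-identityˡ _ ⟩
          M y ^ s                                            ∎

        G≈W : ∀ s i → 0 < i → i < p → G i ^ s ≈ W s (natR i)
        G≈W s i 0<i i<p with euler (𝔽ₚ-natR i) (natR-nonzero i 0<i i<p)
        ... | inj₁ iʰ≈1  = trans (^-congˡ s (G-square i 0<i i<p iʰ≈1)) (sym (W-square s _ iʰ≈1))
        ... | inj₂ iʰ≈-1 = trans (^-congˡ s (G-nonsquare i 0<i i<p iʰ≈-1)) (sym (W-nonsquare s _ iʰ≈-1))

        Σ-split : ∀ g → Σ p g ≈ g 0 + Σ (h ℕ.+ h) (λ i → g (suc i))
        Σ-split g = ≡.subst (λ n → Σ n g ≈ g 0 + Σ (h ℕ.+ h) (λ i → g (suc i))) (≡.sym p≡2h+1) refl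

        <p : ∀ {a} → a ≤ h ℕ.+ h → a < p
        <p {a} a≤2h = ≡.subst (a <_) (≡.sym p≡2h+1) (s≤s a≤2h)

        -- cᵏ = W s (0) for s = 1, 2, via two evaluations of Σ_i G(i)ˢ
        moment : ∀ s → s ≤ 2 → c ^ s ≈ W s 0#
        moment s s≤2 = cancel-right sum-via-G sum-via-W
          where
          rest : Carrier
          rest = Σ (h ℕ.+ h) (λ i → W s (natR (suc i)))
          sum-via-G : c ^ s + rest ≈ 0#
          sum-via-G = begin
            c ^ s + rest                                      ≈⟨ +-cong (^-congˡ s (sym G-zero)) (Σ-cong (h ℕ.+ h) (λ i i<2h → sym (G≈W s (suc i) (s≤s z≤n) (<p i<2h)))) ⟩
            G 0 ^ s + Σ (h ℕ.+ h) (λ i → G (suc i) ^ s)        ≈⟨ Σ-split (λ i → G i ^ s) ⟨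
            Σ p (λ i → G i ^ s)                               ≈⟨ permuted-power-sum G G∈ G-injective s ⟩
            S char s                                          ≈⟨ power-sums-vanish char s (<p (ℕP.≤-trans (s≤s s≤2) (ℕP.≤-trans h≥3 (ℕP.m≤m+n h h)))) ⟩
            0#                                                ∎
          sum-via-W : W s 0# + rest ≈ 0#
          sum-via-W = begin
            W s 0# + rest                                     ≈⟨ Σ-split (λ i → W s (natR i)) ⟨
            Σ p (λ i → W s (natR i))                          ≈⟨ Σ-* p half _ ⟩
            half * Σ p (λ i → P (natR i) * natR i ^ 0 + Q (natR i) * natR i ^ h)
                                                              ≈⟨ *-congˡ (Σ-+ p _ _) ⟩
            half * (Σ p (λ i → P (natR i) * natR i ^ 0) + Σ p (λ i → Q (natR i) * natR i ^ h))
                                                              ≈⟨ *-congˡ (+-cong (quadratic-moment P (quadratic-+ (line-power u₀ u₁ s s≤2) (line-power v₀ v₁ s s≤2)) 0 (<p (ℕP.≤-trans h≥3 (ℕP.m≤m+n h h))))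
                                                                                  (quadratic-moment Q (quadratic-− (line-power u₀ u₁ s s≤2) (line-power v₀ v₁ s s≤2)) h (<p (ℕP.+-monoˡ-≤ h h≥3)))) ⟩
            half * (0# + 0#)                                  ≈⟨ trans (*-congˡ (+-identityʳ 0#)) (zeroʳ half) ⟩
            0#                                                ∎
            where
            P Q : Carrier → Carrier
            P y = L y ^ s + M y ^ s
            Q y = L y ^ s - M y ^ s
          cancel-right : ∀ {a b r} → a + r ≈ 0# → b + r ≈ 0# → a ≈ b
          cancel-right {a} {b} {r} a+r≈0 b+r≈0 = begin
            a             ≈⟨ solve 2 (λ a r → a := (a :+ r) :- r) refl a r ⟩
            (a + r) - r   ≈⟨ +-congʳ (trans a+r≈0 (sym b+r≈0)) ⟩
            (b + r) - r   ≈⟨ solve 2 (λ b r → (b :+ r) :- r := b) refl b r ⟩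
            b             ∎

        two·W-at-0 : ∀ s → two * W s 0# ≈ u₀ ^ s + v₀ ^ s
        two·W-at-0 s = begin
          two * W s 0#                                       ≈⟨ *-congˡ (*-congˡ (+-congˡ (*-congˡ (power-of-zero h h≥1 refl)))) ⟩
          two * (half * ((L 0# ^ s + M 0# ^ s) * 1# + (L 0# ^ s - M 0# ^ s) * 0#))
            ≈⟨ solve 4 (λ t i a b → t :* (i :* (a :* :1 :+ b :* :0)) := (t :* i) :* a) refl two half _ _ ⟩
          two * half * (L 0# ^ s + M 0# ^ s)                ≈⟨ *-congʳ two·half≈1 ⟩
          1# * (L 0# ^ s + M 0# ^ s)                         ≈⟨ *-identityˡ _ ⟩
          L 0# ^ s + M 0# ^ s                                ≈⟨ +-cong (^-congˡ s (constant u₀ u₁)) (^-congˡ s (constant v₀ v₁)) ⟩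
          u₀ ^ s + v₀ ^ s                                    ∎
          where
          constant : ∀ a b → a + b * 0# ≈ a
          constant a b = solve 2 (λ a b → a :+ b :* :0 := a) refl a b

        two·c : two * (c * 1#) ≈ u₀ * 1# + v₀ * 1#
        two·c = trans (*-congˡ (moment 1 (s≤s z≤n))) (two·W-at-0 1)

        two·c² : two * (c * (c * 1#)) ≈ u₀ * (u₀ * 1#) + v₀ * (v₀ * 1#)
        two·c² = trans (*-congˡ (moment 2 (s≤s (s≤s z≤n)))) (two·W-at-0 2)

        -- (u₀ - v₀)² = 2(u₀² + v₀²) - (u₀ + v₀)² = 2·2c² - (2c)² = 0
        difference-squared : (u₀ - v₀) * (u₀ - v₀) ≈ 0#
        difference-squared = begin
          (u₀ - v₀) * (u₀ - v₀)
            ≈⟨ solve 2 (λ u v → (u :- v) :* (u :- v)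
                 := :2 :* (u :* (u :* :1) :+ v :* (v :* :1)) :- (u :* :1 :+ v :* :1) :* (u :* :1 :+ v :* :1)) refl u₀ v₀ ⟩
          two * (u₀ * (u₀ * 1#) + v₀ * (v₀ * 1#)) - (u₀ * 1# + v₀ * 1#) * (u₀ * 1# + v₀ * 1#)
            ≈⟨ +-cong (*-congˡ (sym two·c²)) (-‿cong (*-cong (sym two·c) (sym two·c))) ⟩
          two * (two * (c * (c * 1#))) - (two * (c * 1#)) * (two * (c * 1#))
            ≈⟨ solve 2 (λ t c → t :* (t :* (c :* (c :* :1))) :- (t :* (c :* :1)) :* (t :* (c :* :1)) := :0) refl two c ⟩
          0#  ∎

      two-lines-meet : u₀ ≈ v₀
      two-lines-meet = difference≈0⇒≈ (square-zero difference-squared)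

module Setting (p : ℕ) (pp : Prime p) (3<p : 3 ℕ.< p) (k : ℕ) (k<p : k ℕ.< p)
    (k≢3 : ¬ (k ≡ 3)) (qr : QRCond p k) (F : Field) (e : ℕ) (H : HasOrder F (p ℕ.^ e)) where

  open import Data.Nat using (zero; suc; z≤n; s≤s)
  import Data.Nat.Properties as ℕP
  open import Data.Integer as ℤ using (ℤ)
  open import Data.Product using (_×_; _,_; proj₁; proj₂)
  import Relation.Binary.PropositionalEquality as ≡
  open PrimeArithmetic using (OddWith; odd-prime)
  open PrimeSubfield F H pp public
  open Solver

  char : natR p ≈ 0#
  char = characteristic {p} {e} ≡.refl

  open WithCharacteristic char public

  h : ℕ
  h = proj₁ (odd-prime pp (ℕP.<-trans (s≤s (s≤s (s≤s z≤n))) 3<p))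

  p≡2h+1 : OddWith p h
  p≡2h+1 = proj₂ (odd-prime pp (ℕP.<-trans (s≤s (s≤s (s≤s z≤n))) 3<p))

  open OddCharacteristic h p≡2h+1 public
  open FrobeniusOnAlgebra.Over F H pp h p≡2h+1 char public using (d; ε)

  Dₖ : ℕ → Carrier → Carrier
  Dₖ n x = D F k n x

  D-cong : ∀ n {a b} → a ≈ b → Dₖ n a ≈ Dₖ n b
  D-cong zero          _   = refl
  D-cong (suc zero)    _   = refl
  D-cong (suc (suc n)) a≈b = +-cong (D-cong (suc n) a≈b) (-‿cong (*-cong a≈b (D-cong n a≈b)))

  κ : Carrier
  κ = natF F 2 - natF F k

  three : Carrier
  three = 1# + two

  κ≈2-k : κ ≈ two - natR k
  κ≈2-k = +-cong (natF≈natR 2) (-‿cong (natF≈natR k))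

  𝔽ₚ-κ : In𝔽ₚ κ
  𝔽ₚ-κ = 𝔽ₚ-cong (sym κ≈2-k) (𝔽ₚ-- 𝔽ₚ-two (𝔽ₚ-natR k))

  𝔽ₚ-D : ∀ n {a} → In𝔽ₚ a → In𝔽ₚ (Dₖ n a)
  𝔽ₚ-D n a∈ = proj₁ (consecutive n)
    where
    consecutive : ∀ n → In𝔽ₚ (Dₖ n _) × In𝔽ₚ (Dₖ (suc n) _)
    consecutive zero    = 𝔽ₚ-κ , 𝔽ₚ-natR 1
    consecutive (suc n) = let (Dₙ∈ , Dₙ₊₁∈) = consecutive n
                          in Dₙ₊₁∈ , 𝔽ₚ-- Dₙ₊₁∈ (𝔽ₚ-* a∈ Dₙ∈)

  -- The points x = (1 - w)/4, for which d(x) = 1 - 4x = w.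
  quarter : Carrier
  quarter = half * half

  four·quarter : ∀ w → (two * two) * (w * quarter) ≈ w
  four·quarter w = begin
    (two * two) * (w * quarter)                ≈⟨ solve 3 (λ t i w → (t :* t) :* (w :* (i :* i)) := w :* ((t :* i) :* (t :* i))) refl two half w ⟩
    w * ((two * half) * (two * half))          ≈⟨ *-congˡ (trans (*-cong two·half≈1 two·half≈1) (*-identityʳ 1#)) ⟩
    w * 1#                                     ≈⟨ *-identityʳ w ⟩
    w                                          ∎

  four·quarter≈1 : (two * two) * quarter ≈ 1#
  four·quarter≈1 = trans (*-congˡ (sym (*-identityˡ quarter))) (four·quarter 1#)

  point : Carrier → Carrier
  point w = (1# - w) * quarter

  d-point : ∀ w → d (point w) ≈ w
  d-point w = begin
    1# - (two * two) * ((1# - w) * quarter)    ≈⟨ +-congˡ (-‿cong (four·quarter (1# - w))) ⟩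
    1# - (1# - w)                              ≈⟨ solve 1 (λ w → :1 :- (:1 :- w) := w) refl w ⟩
    w                                          ∎

  d-cong : ∀ {a b} → a ≈ b → d a ≈ d b
  d-cong a≈b = +-congˡ (-‿cong (*-congˡ a≈b))

  𝔽ₚ-point : ∀ {w} → In𝔽ₚ w → In𝔽ₚ (point w)
  𝔽ₚ-point w∈ = 𝔽ₚ-* (𝔽ₚ-- (𝔽ₚ-natR 1) w∈) (𝔽ₚ-* 𝔽ₚ-half 𝔽ₚ-half)

  x₀ : Carrier
  x₀ = point 0#

  β : Carrier
  β = natZ (proj₁ qr)

  𝔽ₚ-β : In𝔽ₚ β
  𝔽ₚ-β = 𝔽ₚ-natZ (proj₁ qr)

  β≉0 : ¬ (β ≈ 0#)
  β≉0 β≈0 = proj₁ (proj₂ qr) (natZ≈0⇒p∣ (proj₁ qr) β≈0)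

  residue-equation : two * (β * β) * (1# + κ) ≈ three * κ - two * three
  residue-equation = difference≈0⇒≈ (begin
    two * (β * β) * (1# + κ) - (three * κ - two * three)
      ≈⟨ solve 2 (λ b κ → :2 :* (b :* b) :* (:1 :+ κ) :- (:3 :* κ :- :2 :* :3)
                       := :- ((b :* b) :* (:2 :* ((:2 :- κ) :- :3)) :- :3 :* (:2 :- κ))) refl β κ ⟩
    - ((β * β) * (two * (k′ - three)) - three * k′)
      ≈⟨ -‿cong (+-cong (*-congˡ (*-congˡ (+-congʳ 2-κ≈k))) (-‿cong (*-congˡ 2-κ≈k))) ⟩
    - ((β * β) * (two * (natR k - three)) - three * natR k)
      ≈⟨ -‿cong in-F ⟩
    - 0#
      ≈⟨ -0#≈0# ⟩
    0#  ∎)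
    where
    k′ : Carrier
    k′ = two - κ
    2-κ≈k : two - κ ≈ natR k
    2-κ≈k = trans (+-congˡ (-‿cong κ≈2-k)) (solve 2 (λ t n → t :- (t :- n) := n) refl two (natR k))
    b : ℤ
    b = proj₁ qr
    in-F : (β * β) * (two * (natR k - three)) - three * natR k ≈ 0#
    in-F = begin
      (β * β) * (two * (natR k - three)) - three * natR k
        ≈⟨ +-cong (*-cong (natZ-* b b) (*-congˡ (natZ-− (ℤ.+ k) (ℤ.+ 3))))
                  (-‿cong (natZ-* (ℤ.+ 3) (ℤ.+ k))) ⟨
      natZ (b ℤ.* b) * (two * natZ (ℤ.+ k ℤ.- ℤ.+ 3)) - natZ (ℤ.+ 3 ℤ.* ℤ.+ k)
        ≈⟨ +-congʳ (*-congˡ (natZ-* (ℤ.+ 2) (ℤ.+ k ℤ.- ℤ.+ 3))) ⟨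
      natZ (b ℤ.* b) * natZ (ℤ.+ 2 ℤ.* (ℤ.+ k ℤ.- ℤ.+ 3)) - natZ (ℤ.+ 3 ℤ.* ℤ.+ k)
        ≈⟨ +-congʳ (natZ-* (b ℤ.* b) (ℤ.+ 2 ℤ.* (ℤ.+ k ℤ.- ℤ.+ 3))) ⟨
      natZ ((b ℤ.* b) ℤ.* (ℤ.+ 2 ℤ.* (ℤ.+ k ℤ.- ℤ.+ 3))) - natZ (ℤ.+ 3 ℤ.* ℤ.+ k)
        ≈⟨ natZ-− ((b ℤ.* b) ℤ.* (ℤ.+ 2 ℤ.* (ℤ.+ k ℤ.- ℤ.+ 3))) (ℤ.+ 3 ℤ.* ℤ.+ k) ⟨
      natZ ((b ℤ.* b) ℤ.* (ℤ.+ 2 ℤ.* (ℤ.+ k ℤ.- ℤ.+ 3)) ℤ.- ℤ.+ 3 ℤ.* ℤ.+ k)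
        ≈⟨ p∣⇒natZ≈0 ((b ℤ.* b) ℤ.* (ℤ.+ 2 ℤ.* (ℤ.+ k ℤ.- ℤ.+ 3)) ℤ.- ℤ.+ 3 ℤ.* ℤ.+ k) (proj₂ (proj₂ qr)) ⟩
      0#  ∎
      where
      natZ-− : ∀ i j → natZ (i ℤ.- j) ≈ natZ i - natZ j
      natZ-− i j = trans (natZ-+ i (ℤ.- j)) (+-congˡ (natZ-neg j))

  eight : Carrier
  eight = two * (two * two)

  eight≉0 : ¬ (eight ≈ 0#)
  eight≉0 = nonzero-* two≉0 (nonzero-* two≉0 two≉0)

  three≉0 : ¬ (three ≈ 0#)
  three≉0 = natR-nonzero 3 (s≤s z≤n) 3<p

  -- k ≠ 0 in F, i.e. κ ≠ 2: otherwise the residue equation forces β = 0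
  κ≉2 : ¬ (κ ≈ two)
  κ≉2 κ≈2 = β≉0 (cancel-zero β≉0 (cancel-zero (nonzero-* two≉0 three≉0) (begin
    two * three * (β * β)            ≈⟨ solve 3 (λ t h b → t :* h :* (b :* b) := t :* (b :* b) :* h) refl two three β ⟩
    two * (β * β) * three            ≈⟨ *-congˡ (+-congˡ κ≈2) ⟨
    two * (β * β) * (1# + κ)         ≈⟨ residue-equation ⟩
    three * κ - two * three          ≈⟨ +-congʳ (trans (*-congˡ κ≈2) (*-comm three two)) ⟩
    two * three - two * three        ≈⟨ -‿inverseʳ _ ⟩
    0#                               ∎)))

  1+κ≉0 : ¬ (1# + κ ≈ 0#)
  1+κ≉0 1+κ≈0 = k≢3 (≡.sym (natR-injective 3<p k<p (begin
    three                            ≈⟨ solve 2 (λ t n → :1 :+ t := (:1 :+ (t :- n)) :+ n) refl two (natR k) ⟩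
    (1# + (two - natR k)) + natR k   ≈⟨ +-congʳ (+-congˡ κ≈2-k) ⟨
    (1# + κ) + natR k                ≈⟨ +-congʳ 1+κ≈0 ⟩
    0# + natR k                      ≈⟨ +-identityˡ _ ⟩
    natR k                           ∎)))

  D₃-affine : ∀ x → Dₖ 3 x ≈ 1# - x * (1# + κ)
  D₃-affine x = solve 2 (λ x κ → (:1 :- x :* κ) :- x :* :1 := :1 :- x :* (:1 :+ κ)) refl x κ

  D₃-preimage : Carrier → Carrier
  D₃-preimage c = (1# - c) * inv (1# + κ) 1+κ≉0

  𝔽ₚ-D₃-preimage : ∀ {c} → In𝔽ₚ c → In𝔽ₚ (D₃-preimage c)
  𝔽ₚ-D₃-preimage c∈ = 𝔽ₚ-* (𝔽ₚ-- (𝔽ₚ-natR 1) c∈) (𝔽ₚ-inv (𝔽ₚ-+ (𝔽ₚ-natR 1) 𝔽ₚ-κ) 1+κ≉0)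

  D₃-preimage-slope : ∀ c → D₃-preimage c * (1# + κ) ≈ 1# - c
  D₃-preimage-slope c = begin
    (1# - c) * inv (1# + κ) 1+κ≉0 * (1# + κ)       ≈⟨ *-assoc _ _ _ ⟩
    (1# - c) * (inv (1# + κ) 1+κ≉0 * (1# + κ))     ≈⟨ *-congˡ (trans (*-comm _ _) (inverseʳ _ 1+κ≉0)) ⟩
    (1# - c) * 1#                                  ≈⟨ *-identityʳ _ ⟩
    1# - c                                         ∎

  D₃-section : ∀ c → Dₖ 3 (D₃-preimage c) ≈ c
  D₃-section c = begin
    Dₖ 3 (D₃-preimage c)                 ≈⟨ D₃-affine _ ⟩
    1# - D₃-preimage c * (1# + κ)        ≈⟨ +-congˡ (-‿cong (D₃-preimage-slope c)) ⟩
    1# - (1# - c)                        ≈⟨ solve 1 (λ c → :1 :- (:1 :- c) := c) refl c ⟩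
    c                                    ∎

  D₃-injective : ∀ {a b} → Dₖ 3 a ≈ Dₖ 3 b → a ≈ b
  D₃-injective {a} {b} D₃a≈D₃b = cancel 1+κ≉0 (begin
    (1# + κ) * a                 ≈⟨ solve 2 (λ a κ → (:1 :+ κ) :* a := :1 :- (:1 :- a :* (:1 :+ κ))) refl a κ ⟩
    1# - (1# - a * (1# + κ))     ≈⟨ +-congˡ (-‿cong (trans (sym (D₃-affine a)) (trans D₃a≈D₃b (D₃-affine b)))) ⟩
    1# - (1# - b * (1# + κ))     ≈⟨ solve 2 (λ b κ → :1 :- (:1 :- b :* (:1 :+ κ)) := (:1 :+ κ) :* b) refl b κ ⟩
    (1# + κ) * b                 ∎)

  D₃-permutes : IsPermPoly F k 3
  D₃-permutes = D₃-injective , λ y → D₃-preimage y , λ z≈ → trans (D-cong 3 z≈) (D₃-section y)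

  -- The residue point x₁ = (1 - β²)/4: d(x₁) = β² is a nonzero square, so
  -- ε(x₁) = β^(p-1) = 1, and the residue condition says exactly D₃(x₁) = κ/8.
  residue-point : Carrier
  residue-point = point (β * β)

  𝔽ₚ-residue-point : In𝔽ₚ residue-point
  𝔽ₚ-residue-point = 𝔽ₚ-point (𝔽ₚ-* 𝔽ₚ-β 𝔽ₚ-β)

  ε-residue-point : ε residue-point ≈ 1#
  ε-residue-point = begin
    d residue-point ^ h   ≈⟨ ^-congˡ h (d-point (β * β)) ⟩
    (β * β) ^ h           ≈⟨ ^-distrib-* β β h ⟩
    β ^ h * β ^ h         ≈⟨ ^-homo-* β h h ⟨
    β ^ (h ℕ.+ h)         ≈⟨ fermat-little 𝔽ₚ-β β≉0 ⟩
    1#                    ∎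

  eight·D₃-residue-point : eight * Dₖ 3 residue-point ≈ κ
  eight·D₃-residue-point = begin
    eight * Dₖ 3 residue-point                              ≈⟨ *-congˡ (D₃-affine residue-point) ⟩
    eight * (1# - residue-point * (1# + κ))
      ≈⟨ solve 4 (λ t b κ q → t :* (t :* t) :* (:1 :- (:1 :- b :* b) :* q :* (:1 :+ κ))
                         := t :* (t :* t) :- t :* ((:1 :- b :* b) :* (:1 :+ κ)) :* ((t :* t) :* q)) refl two β κ quarter ⟩
    eight - two * ((1# - β * β) * (1# + κ)) * ((two * two) * quarter)
      ≈⟨ +-congˡ (-‿cong (*-congˡ four·quarter≈1)) ⟩
    eight - two * ((1# - β * β) * (1# + κ)) * 1#
      ≈⟨ solve 3 (λ t b κ → t :* (t :* t) :- t :* ((:1 :- b :* b) :* (:1 :+ κ)) :* :1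
                         := (t :* (t :* t) :- t :* (:1 :+ κ)) :+ t :* (b :* b) :* (:1 :+ κ)) refl two β κ ⟩
    (eight - two * (1# + κ)) + two * (β * β) * (1# + κ)     ≈⟨ +-congˡ residue-equation ⟩
    (eight - two * (1# + κ)) + (three * κ - two * three)
      ≈⟨ solve 1 (λ κ → (:2 :* (:2 :* :2) :- :2 :* (:1 :+ κ)) :+ (:3 :* κ :- :2 :* :3) := κ) refl κ ⟩
    κ                                                       ∎

module ValuesOfDₙ (p : ℕ) (pp : Prime p) (3<p : 3 ℕ.< p) (k : ℕ) (k<p : k ℕ.< p)
    (k≢3 : ¬ (k ≡ 3)) (qr : QRCond p k) (F : Field) (e : ℕ) (H : HasOrder F (p ℕ.^ e))
    (l₁ l₂ l₃ : ℕ) where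

  open import Data.Nat using (suc; _∸_; _≤_; s≤s)
  import Data.Nat.Properties as ℕP
  open import Data.List using (List; []; _∷_)
  open import Data.Product using (_,_)
  import Relation.Binary.PropositionalEquality as ≡
  open ExponentCounting using (count; is-zero; is-odd)
  open Setting p pp 3<p k k<p k≢3 qr F e H public
  open DicksonAtPrimePoints F H pp h p≡2h+1 using (N; D-at-N-singular; D-at-N-residue; D-at-N-nonresidue)
  open Solver

  exponents : List ℕ
  exponents = l₁ ∷ l₂ ∷ l₃ ∷ []

  n : ℕ
  n = p ℕ.^ l₁ ℕ.+ p ℕ.^ l₂ ℕ.+ p ℕ.^ l₃

  n≡N : n ≡ N exponents
  n≡N = ≡.trans (ℕP.+-assoc (p ℕ.^ l₁) (p ℕ.^ l₂) (p ℕ.^ l₃))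
                (≡.cong (λ m → p ℕ.^ l₁ ℕ.+ (p ℕ.^ l₂ ℕ.+ m)) (≡.sym (ℕP.+-identityʳ (p ℕ.^ l₃))))

  Dₙ≈D_N : ∀ x → Dₖ n x ≈ Dₖ (N exponents) x
  Dₙ≈D_N x = reflexive (≡.cong (λ m → Dₖ m x) n≡N)

  J R : ℕ
  J = count is-zero exponents
  R = count is-odd exponents

  Dₙ-at-x₀ : Dₖ n x₀ ≈ half ^ (3 ∸ J) * Dₖ J x₀
  Dₙ-at-x₀ = trans (Dₙ≈D_N x₀) (D-at-N-singular char k x₀ (𝔽ₚ-point (𝔽ₚ-natR 0)) (d-point 0#) exponents)

  Dₙ-at-residue : ∀ {x} → In𝔽ₚ x → ε x ≈ 1# → Dₖ n x ≈ Dₖ 3 x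
  Dₙ-at-residue {x} x∈ ε≈1 = trans (Dₙ≈D_N x) (D-at-N-residue char k x x∈ ε≈1 exponents)

  nonresidue-value : ℕ → Carrier → Carrier
  nonresidue-value 0 x = Dₖ 3 x
  nonresidue-value 1 x = x * 1#
  nonresidue-value _ x = x * (κ - 1#)

  Dₙ-at-nonresidue : ∀ {x} r → R ≡ r → r ≤ 2 → In𝔽ₚ x → ε x ≈ - 1# → Dₖ n x ≈ nonresidue-value r x
  Dₙ-at-nonresidue {x} r R≡r r≤2 x∈ ε≈-1 =
    trans (Dₙ≈D_N x) (trans (D-at-N-nonresidue char k x x∈ ε≈-1 exponents)
                            (≡.subst (λ m → Φ 0 (U A.^ m ⊗ T A.^ (3 ∸ m)) ≈ nonresidue-value r x)
                                     (≡.sym R≡r) (value r r≤2)))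
    where
    open DicksonTrace F k x hiding (κ)
    module S = A.Solver
    -- T·U = x turns U^r T^(3-r) into a scalar multiple of T^(3-2r) or U
    value : ∀ r → r ≤ 2 → Φ 0 (U A.^ r ⊗ T A.^ (3 ∸ r)) ≈ nonresidue-value r x
    value 0 _ = trans (Φ-cong 0 (A.*-identityˡ _)) (sym (D-trace 3))
    value 1 _ = begin
      Φ 0 (U A.^ 1 ⊗ T A.^ 2)     ≈⟨ Φ-cong 0 (A.trans (S.solve 2 (λ t u → (u S.:* S.:1) S.:* (t S.:* (t S.:* S.:1))
                                                          S.:= (t S.:* u) S.:* (t S.:* S.:1)) A.refl T U)
                                                (A.*-congʳ T·U≋x)) ⟩
      Φ 0 (ι x ⊗ T A.^ 1)         ≈⟨ Φ-scalar x (T A.^ 1) ⟩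
      x * Φ 0 (T A.^ 1)           ≈⟨ *-congˡ (sym (D-trace 1)) ⟩
      x * 1#                      ∎
    value 2 _ = begin
      Φ 0 (U A.^ 2 ⊗ T A.^ 1)     ≈⟨ Φ-cong 0 (A.trans (S.solve 2 (λ t u → (u S.:* (u S.:* S.:1)) S.:* (t S.:* S.:1)
                                                          S.:= (t S.:* u) S.:* u) A.refl T U)
                                                (A.*-congʳ T·U≋x)) ⟩
      Φ 0 (ι x ⊗ U)               ≈⟨ Φ-scalar x U ⟩
      x * Φ 0 U                   ≈⟨ *-congˡ Φ-U ⟩
      x * (κ - 1#)                ∎
    value (suc (suc (suc _))) (s≤s (s≤s ()))

module Collisions (p : ℕ) (pp : Prime p) (3<p : 3 ℕ.< p) (k : ℕ) (k<p : k ℕ.< p)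
    (k≢3 : ¬ (k ≡ 3)) (qr : QRCond p k) (F : Field) (e : ℕ) (H : HasOrder F (p ℕ.^ e))
    (l₁ l₂ l₃ : ℕ) (perm : IsPermPoly F k (p ℕ.^ l₁ ℕ.+ p ℕ.^ l₂ ℕ.+ p ℕ.^ l₃)) where

  open import Data.Nat using (suc; _≤_; z≤n; s≤s)
  open import Data.Product using (_×_; _,_; proj₁)
  open import Data.Sum using (_⊎_; inj₁; inj₂; [_,_]′)
  open import Data.Empty using (⊥)
  import Data.Integer as ℤ
  import Relation.Binary.PropositionalEquality as ≡
  open ValuesOfDₙ p pp 3<p k k<p k≢3 qr F e H l₁ l₂ l₃ public
  open Solver
  open Field F using (1≉0)

  Dₙ-injective : ∀ {a b} → Dₖ n a ≈ Dₖ n b → a ≈ b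
  Dₙ-injective = proj₁ perm

  only-x₀-is-singular : ∀ {y} → Dₖ n y ≈ Dₖ n x₀ → d y ≈ 0#
  only-x₀-is-singular Dₙy≈Dₙx₀ = trans (d-cong (Dₙ-injective Dₙy≈Dₙx₀)) (d-point 0#)

  -- J = 0: Dₙ(x₀) = κ/8 = D₃(x₁) = Dₙ(x₁) at the residue point x₁ ≠ x₀.
  no-exponent-zero : J ≡ 0 → ⊥
  no-exponent-zero J≡0 = β≉0 (square-zero β²≈0)
    where
    eight·Dₙx₀ : eight * Dₖ n x₀ ≈ κ
    eight·Dₙx₀ = begin
      eight * Dₖ n x₀                       ≈⟨ *-congˡ Dₙ-at-x₀ ⟩
      eight * (half ^ (3 ℕ.∸ J) * Dₖ J x₀)  ≡⟨ ≡.cong (λ j → eight * (half ^ (3 ℕ.∸ j) * Dₖ j x₀)) J≡0 ⟩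
      eight * (half ^ 3 * κ)
        ≈⟨ solve 3 (λ t i κ → t :* (t :* t) :* (i :* (i :* (i :* :1)) :* κ)
                          := (t :* i) :* ((t :* i) :* ((t :* i) :* κ))) refl two half κ ⟩
      two * half * (two * half * (two * half * κ))
        ≈⟨ *-cong two·half≈1 (*-cong two·half≈1 (*-congʳ two·half≈1)) ⟩
      1# * (1# * (1# * κ))                  ≈⟨ trans (*-identityˡ _) (trans (*-identityˡ _) (*-identityˡ _)) ⟩
      κ                                     ∎
    collision : Dₖ n residue-point ≈ Dₖ n x₀
    collision = trans (Dₙ-at-residue 𝔽ₚ-residue-point ε-residue-point)
                      (cancel eight≉0 (trans eight·D₃-residue-point (sym eight·Dₙx₀)))
    β²≈0 : β * β ≈ 0#
    β²≈0 = trans (sym (d-point (β * β))) (only-x₀-is-singular collision)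

  x₀-value-regular : J ≡ 1 ⊎ J ≡ 2 → (two * two) * (1# - Dₖ n x₀) ≈ 1# + κ → κ ≈ two
  x₀-value-regular (inj₁ J≡1) 4[1-c]≈1+κ = begin
    κ                                              ≈⟨ solve 1 (λ κ → κ := (:1 :+ κ) :- :1) refl κ ⟩
    (1# + κ) - 1#                                  ≈⟨ +-congʳ (trans (sym 4[1-c]≈1+κ) (*-congˡ (+-congˡ (-‿cong c≈)))) ⟩
    (two * two) * (1# - half * (half * 1#) * 1#) - 1#
      ≈⟨ solve 2 (λ t i → (t :* t) :* (:1 :- i :* (i :* :1) :* :1) :- :1 := (t :* t :- (t :* i) :* (t :* i)) :- :1) refl two half ⟩
    (two * two - (two * half) * (two * half)) - 1#  ≈⟨ +-congʳ (+-congˡ (-‿cong (trans (*-cong two·half≈1 two·half≈1) (*-identityˡ 1#)))) ⟩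
    (two * two - 1#) - 1#                          ≈⟨ solve 0 ((:2 :* :2 :- :1) :- :1 := :2) refl ⟩
    two                                            ∎
    where
    c≈ : Dₖ n x₀ ≈ half * (half * 1#) * 1#
    c≈ = trans Dₙ-at-x₀ (reflexive (≡.cong (λ j → half ^ (3 ℕ.∸ j) * Dₖ j x₀) J≡1))
  x₀-value-regular (inj₂ J≡2) 4[1-c]≈1+κ = begin
    κ                                              ≈⟨ solve 1 (λ κ → κ := (:2 :* (:1 :+ κ) :- (:2 :* :2 :+ κ)) :+ :2) refl κ ⟩
    (two * (1# + κ) - (two * two + κ)) + two       ≈⟨ +-congʳ (difference≈0 doubled) ⟩
    0# + two                                       ≈⟨ +-identityˡ two ⟩
    two                                            ∎
    where
    c≈ : Dₖ n x₀ ≈ half * 1# * (1# - (1# - 0#) * quarter * κ)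
    c≈ = trans Dₙ-at-x₀ (reflexive (≡.cong (λ j → half ^ (3 ℕ.∸ j) * Dₖ j x₀) J≡2))
    doubled : two * (1# + κ) ≈ two * two + κ
    doubled = begin
      two * (1# + κ)                                 ≈⟨ *-congˡ (trans (sym 4[1-c]≈1+κ) (*-congˡ (+-congˡ (-‿cong c≈)))) ⟩
      two * ((two * two) * (1# - half * 1# * (1# - (1# - 0#) * quarter * κ)))
        ≈⟨ solve 3 (λ t i κ → t :* ((t :* t) :* (:1 :- i :* :1 :* (:1 :- (:1 :- :0) :* (i :* i) :* κ)))
                            := t :* t :* t :- t :* t :* (t :* i) :+ ((t :* i) :* (t :* i)) :* (t :* i) :* κ) refl two half κ ⟩
      two * two * two - two * two * (two * half) + ((two * half) * (two * half)) * (two * half) * κ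
        ≈⟨ +-cong (+-congˡ (-‿cong (*-congˡ two·half≈1))) (*-congʳ (*-cong (*-cong two·half≈1 two·half≈1) two·half≈1)) ⟩
      two * two * two - two * two * 1# + (1# * 1#) * 1# * κ
        ≈⟨ solve 1 (λ κ → :2 :* :2 :* :2 :- :2 :* :2 :* :1 :+ (:1 :* :1) :* :1 :* κ := :2 :* :2 :+ κ) refl κ ⟩
      two * two + κ                                  ∎

  ε-sign : ∀ {x} → In𝔽ₚ x → ¬ (d x ≈ 0#) → ε x ≈ 1# ⊎ ε x ≈ - 1#
  ε-sign x∈ d≉0 = euler (𝔽ₚ-- (𝔽ₚ-natR 1) (𝔽ₚ-* (𝔽ₚ-* 𝔽ₚ-two 𝔽ₚ-two) x∈)) d≉0

  -- R = 0 and J ∈ {1, 2}: Dₙ agrees with D₃ off x₀, and D₃ takes the value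
  -- c = Dₙ(x₀) at its preimage y₀ ≠ x₀.
  no-odd-exponent : R ≡ 0 → J ≡ 1 ⊎ J ≡ 2 → ⊥
  no-odd-exponent R≡0 J∈ = d-y₀≉0 (only-x₀-is-singular Dₙy₀≈c)
    where
    c y₀ : Carrier
    c  = Dₖ n x₀
    y₀ = D₃-preimage c
    y₀∈ : In𝔽ₚ y₀
    y₀∈ = 𝔽ₚ-D₃-preimage (𝔽ₚ-D n (𝔽ₚ-point (𝔽ₚ-natR 0)))
    d-y₀≉0 : ¬ (d y₀ ≈ 0#)
    d-y₀≉0 d-y₀≈0 = κ≉2 (x₀-value-regular J∈ (begin
      (two * two) * (1# - c)               ≈⟨ *-congˡ (D₃-preimage-slope c) ⟨
      (two * two) * (y₀ * (1# + κ))        ≈⟨ *-assoc _ _ _ ⟨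
      ((two * two) * y₀) * (1# + κ)        ≈⟨ *-congʳ 4y₀≈1 ⟩
      1# * (1# + κ)                        ≈⟨ *-identityˡ _ ⟩
      1# + κ                               ∎))
      where
      4y₀≈1 : (two * two) * y₀ ≈ 1#
      4y₀≈1 = sym (difference≈0⇒≈ d-y₀≈0)
    Dₙy₀≈c : Dₖ n y₀ ≈ c
    Dₙy₀≈c = trans ([ Dₙ-at-residue y₀∈ , Dₙ-at-nonresidue 0 R≡0 z≤n y₀∈ ]′ (ε-sign y₀∈ d-y₀≉0)) (D₃-section c)

  -- For R ∈ {1, 2}, Dₙ(x) = x·w on non-residue points, with w = 1 or κ - 1.
  -- w = 1 for R = 1 and w = κ - 1 for R = 2
  slope : ℕ → Carrier
  slope 1 = 1#
  slope _ = κ - 1#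

  slope-irregular : ∀ r → r ≡ 1 ⊎ r ≡ 2 → (two * two) - (1# + κ) ≈ slope r → κ ≈ two
  slope-irregular _ (inj₁ ≡.refl) 4-[1+κ]≈1 = begin
    κ                                   ≈⟨ solve 1 (λ κ → κ := (:2 :* :2 :- :1) :- (:2 :* :2 :- (:1 :+ κ))) refl κ ⟩
    (two * two - 1#) - (two * two - (1# + κ))   ≈⟨ +-congˡ (-‿cong 4-[1+κ]≈1) ⟩
    (two * two - 1#) - 1#               ≈⟨ solve 0 ((:2 :* :2 :- :1) :- :1 := :2) refl ⟩
    two                                 ∎
  slope-irregular _ (inj₂ ≡.refl) 4-[1+κ]≈κ-1 = cancel two≉0 (begin
    two * κ                             ≈⟨ solve 1 (λ κ → :2 :* κ := ((κ :- :1) :- (:2 :* :2 :- (:1 :+ κ))) :+ :2 :* :2) refl κ ⟩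
    ((κ - 1#) - (two * two - (1# + κ))) + two * two   ≈⟨ +-congʳ (difference≈0 (sym 4-[1+κ]≈κ-1)) ⟩
    0# + two * two                      ≈⟨ +-identityˡ _ ⟩
    two * two                           ∎)

  nonresidue-slope : ∀ {x} r → R ≡ r → r ≡ 1 ⊎ r ≡ 2 → In𝔽ₚ x → ε x ≈ - 1# → Dₖ n x ≈ x * slope r
  nonresidue-slope r R≡r (inj₁ ≡.refl) = Dₙ-at-nonresidue 1 R≡r (s≤s z≤n)
  nonresidue-slope r R≡r (inj₂ ≡.refl) = Dₙ-at-nonresidue 2 R≡r (s≤s (s≤s z≤n))

  -- p ≥ 7, R ∈ {1, 2}: along y ↦ (1 - y)/4 the permutation Dₙ of 𝔽ₚ is
  -- affine on the squares and on the non-squares; the two lines must meet at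
  -- 0, which forces κ = 2.
  mixed-large-p : 7 ≤ p → ∀ r → R ≡ r → r ≡ 1 ⊎ r ≡ 2 → ⊥
  mixed-large-p 7≤p r R≡r r∈ = κ≉2 (slope-irregular r r∈ (begin
    (two * two) - (1# + κ)                    ≈⟨ solve 3 (λ t κ q → t :* t :- (:1 :+ κ) := t :* t :* (:1 :- (:1 :+ κ) :* q) :+ (:1 :+ κ) :* (t :* t :* q :- :1)) refl two κ quarter ⟩
    (two * two) * u₀ + (1# + κ) * ((two * two) * quarter - 1#)
                                              ≈⟨ +-cong (*-congˡ lines-meet) (*-congˡ (+-congʳ four·quarter≈1)) ⟩
    (two * two) * v₀ + (1# + κ) * (1# - 1#)   ≈⟨ +-cong (four·quarter (slope r)) (trans (*-congˡ (-‿inverseʳ 1#)) (zeroʳ _)) ⟩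
    slope r + 0#                              ≈⟨ +-identityʳ _ ⟩
    slope r                                   ∎))
    where
    open TwoLinePermutations.Over F H pp h p≡2h+1 char using (two-lines-meet)
    G : ℕ → Carrier
    G i = Dₖ n (point (natR i))
    u₀ u₁ v₀ v₁ : Carrier
    u₀ = 1# - (1# + κ) * quarter
    u₁ = (1# + κ) * quarter
    v₀ = slope r * quarter
    v₁ = - (slope r * quarter)
    ε-point : ∀ i → ε (point (natR i)) ≈ natR i ^ h
    ε-point i = ^-congˡ h (d-point (natR i))
    G-injective : ∀ {i j} → i ℕ.< p → j ℕ.< p → G i ≈ G j → i ≡ j
    G-injective i<p j<p Gi≈Gj = natR-injective i<p j<p
      (trans (sym (d-point _)) (trans (d-cong (Dₙ-injective Gi≈Gj)) (d-point _)))
    G-square : ∀ i → 0 ℕ.< i → i ℕ.< p → natR i ^ h ≈ 1# → G i ≈ u₀ + u₁ * natR i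
    G-square i _ _ iʰ≈1 = begin
      G i                                     ≈⟨ Dₙ-at-residue (𝔽ₚ-point (𝔽ₚ-natR i)) (trans (ε-point i) iʰ≈1) ⟩
      Dₖ 3 (point (natR i))                   ≈⟨ D₃-affine _ ⟩
      1# - (1# - natR i) * quarter * (1# + κ) ≈⟨ solve 3 (λ m q κ → :1 :- (:1 :- m) :* q :* (:1 :+ κ) := (:1 :- (:1 :+ κ) :* q) :+ ((:1 :+ κ) :* q) :* m) refl (natR i) quarter κ ⟩
      u₀ + u₁ * natR i                        ∎
    G-nonsquare : ∀ i → 0 ℕ.< i → i ℕ.< p → natR i ^ h ≈ - 1# → G i ≈ v₀ + v₁ * natR i
    G-nonsquare i _ _ iʰ≈-1 = begin
      G i                                     ≈⟨ nonresidue-slope r R≡r r∈ (𝔽ₚ-point (𝔽ₚ-natR i)) (trans (ε-point i) iʰ≈-1) ⟩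
      (1# - natR i) * quarter * slope r       ≈⟨ solve 3 (λ m q w → (:1 :- m) :* q :* w := w :* q :+ (:- (w :* q)) :* m) refl (natR i) quarter (slope r) ⟩
      v₀ + v₁ * natR i                        ∎
    lines-meet : u₀ ≈ v₀
    lines-meet = two-lines-meet (PrimeArithmetic.half-≥3 p≡2h+1 7≤p) G (λ i → 𝔽ₚ-D n (𝔽ₚ-point (𝔽ₚ-natR i)))
                   G-injective u₀ u₁ v₀ v₁ (G 0) refl G-square G-nonsquare

  module Mod5 (p≡5 : p ≡ 5) where
    five : ∀ {m} → Polynomial m
    five = con (ℤ.+ 5)

    five≈0 : natR 5 ≈ 0#
    five≈0 = ≡.subst (λ q → natR q ≈ 0#) p≡5 char

    ε-value : ∀ {x} ε₀ m → d x * (d x * 1#) ≈ ε₀ + natR 5 * m → ε x ≈ ε₀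
    ε-value {x} ε₀ m d²≈ = begin
      d x ^ h                  ≡⟨ ≡.cong (d x ^_) h≡2 ⟩
      d x * (d x * 1#)         ≈⟨ d²≈ ⟩
      ε₀ + natR 5 * m          ≈⟨ +-congˡ (trans (*-congʳ five≈0) (zeroˡ m)) ⟩
      ε₀ + 0#                  ≈⟨ +-identityʳ ε₀ ⟩
      ε₀                       ∎
      where
      h≡2 : h ≡ 2
      h≡2 = PrimeArithmetic.half-of-5 (≡.trans (≡.sym p≡5) p≡2h+1)

  -- p = 5 (h = 2): explicit collisions, Dₙ(0) = Dₙ(1) for R = 1 and
  -- Dₙ(2) = Dₙ(3) for R = 2.
  mixed-p=5 : p ≡ 5 → ∀ r → R ≡ r → r ≡ 1 ⊎ r ≡ 2 → ⊥
  mixed-p=5 p≡5 r R≡r (inj₁ ≡.refl) = 1≉0 (sym (Dₙ-injective (begin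
    Dₖ n 0#                  ≈⟨ Dₙ-at-residue (𝔽ₚ-natR 0) (ε-value 1# 0# (solve 1 (λ t →
                                   (:1 :- t :* t :* :0) :* ((:1 :- t :* t :* :0) :* :1) := :1 :+ five :* :0) refl two)) ⟩
    Dₖ 3 0#                  ≈⟨ solve 1 (λ κ → (:1 :- :0 :* κ) :- :0 :* :1 := :1 :* :1) refl κ ⟩
    1# * 1#                  ≈⟨ nonresidue-slope 1 R≡r (inj₁ ≡.refl) (𝔽ₚ-natR 1) (ε-value (- 1#) (natR 2) (solve 0
                                   ((:1 :- :2 :* :2 :* :1) :* ((:1 :- :2 :* :2 :* :1) :* :1) := :- :1 :+ five :* :2) refl)) ⟨
    Dₖ n 1#                  ∎)))
    where open Mod5 p≡5
  mixed-p=5 p≡5 r R≡r (inj₂ ≡.refl) = 1≉0 (begin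
    1#                       ≈⟨ solve 0 (:1 := :3 :- :2) refl ⟩
    three - two              ≈⟨ difference≈0 (Dₙ-injective (begin
      Dₖ n three                 ≈⟨ Dₙ-at-residue (𝔽ₚ-natR 3) (ε-value 1# (natR 24) (solve 0
                                     ((:1 :- :2 :* :2 :* :3) :* ((:1 :- :2 :* :2 :* :3) :* :1) := :1 :+ five :* con (ℤ.+ 24)) refl)) ⟩
      Dₖ 3 three                 ≈⟨ solve 1 (λ κ → (:1 :- :3 :* κ) :- :3 :* :1 := :2 :* (κ :- :1) :- five :* κ) refl κ ⟩
      two * (κ - 1#) - natR 5 * κ  ≈⟨ +-congˡ (-‿cong (trans (*-congʳ five≈0) (zeroˡ κ))) ⟩
      two * (κ - 1#) - 0#          ≈⟨ trans (+-congˡ -0#≈0#) (+-identityʳ _) ⟩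
      two * (κ - 1#)               ≈⟨ nonresidue-slope 2 R≡r (inj₂ ≡.refl) 𝔽ₚ-two (ε-value (- 1#) (natR 10) (solve 0
                                     ((:1 :- :2 :* :2 :* :2) :* ((:1 :- :2 :* :2 :* :2) :* :1) := :- :1 :+ five :* con (ℤ.+ 10)) refl)) ⟨
      Dₖ n two                   ∎)) ⟩
    0#                       ∎)
    where open Mod5 p≡5

  mixed : ∀ r → R ≡ r → r ≡ 1 ⊎ r ≡ 2 → ⊥
  mixed r R≡r r∈ = [ (λ p≡5 → mixed-p=5 p≡5 r R≡r r∈) , (λ 7≤p → mixed-large-p 7≤p r R≡r r∈) ]′
                   (PrimeArithmetic.five-or-≥7 pp 3<p)

  collision : ∀ j r → j ℕ.+ r ≤ 3 → ¬ (j ≡ 3) → J ≡ j → R ≡ r → ⊥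
  collision 0 _       _ _ J≡0 _   = no-exponent-zero J≡0
  collision 1 0       _ _ J≡1 R≡0 = no-odd-exponent R≡0 (inj₁ J≡1)
  collision 2 0       _ _ J≡2 R≡0 = no-odd-exponent R≡0 (inj₂ J≡2)
  collision 1 1       _ _ _   R≡1 = mixed 1 R≡1 (inj₁ ≡.refl)
  collision 1 2       _ _ _   R≡2 = mixed 2 R≡2 (inj₂ ≡.refl)
  collision 2 1       _ _ _   R≡1 = mixed 1 R≡1 (inj₁ ≡.refl)
  collision 3 _       _ J≢3 _ _   = J≢3 ≡.refl
  collision 1 (suc (suc (suc _))) (s≤s (s≤s (s≤s ()))) _ _ _
  collision 2 (suc (suc _))       (s≤s (s≤s (s≤s ()))) _ _ _
  collision (suc (suc (suc (suc _)))) _ (s≤s (s≤s (s≤s ()))) _ _ _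

  exponents-vanish : l₁ ≡ 0 × l₂ ≡ 0 × l₃ ≡ 0
  exponents-vanish = by-cases (J ℕ.≟ 3)
    where
    open ExponentCounting using (is-zero; is-odd; count-full; count-disjoint; zero-not-odd; is-zero-sound)
    open import Data.List.Relation.Unary.All using (_∷_)
    open import Relation.Nullary using (Dec; yes; no)
    by-cases : Dec (J ≡ 3) → l₁ ≡ 0 × l₂ ≡ 0 × l₃ ≡ 0
    by-cases (yes J≡3) with count-full is-zero exponents J≡3
    ... | z₁ ∷ z₂ ∷ z₃ ∷ _ = is-zero-sound z₁ , is-zero-sound z₂ , is-zero-sound z₃
    by-cases (no J≢3) = ⊥-elim (collision J R (count-disjoint is-zero is-odd zero-not-odd exponents)
                                          J≢3 ≡.refl ≡.refl)
      where open import Data.Empty using (⊥-elim)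

open import Data.Nat using (_+_; _^_; _<_; _≤_)
open import Data.Product using (_×_; _,_)
open import Relation.Binary.PropositionalEquality using (refl)
open import Function.Bundles using (_⇔_; mk⇔)

mainTheorem14 : (p : ℕ) → Prime p → 3 < p →
    (k : ℕ) → k < p → ¬ (k ≡ 3) →
    (e : ℕ) → 1 ≤ e →
    (l₁ l₂ l₃ : ℕ) →
    QRCond p k →
    (F : Field) → HasOrder F (p ^ e) →
    (IsPermPoly F k (p ^ l₁ + p ^ l₂ + p ^ l₃) ⇔ (l₁ ≡ 0 × l₂ ≡ 0 × l₃ ≡ 0))
mainTheorem14 p pp 3<p k k<p k≢3 e _ l₁ l₂ l₃ qr F H = mk⇔
  (Collisions.exponents-vanish p pp 3<p k k<p k≢3 qr F e H l₁ l₂ l₃)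
  (λ { (refl , refl , refl) → Setting.D₃-permutes p pp 3<p k k<p k≢3 qr F e H })
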